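{- Let $0\le p\le \frac12$. Then $\mathbb{P}\big(\mathcal{R}^{(3)}(n,p)\text{ is Turánnical}\big)=o(1)$ as $n\to\infty$.
   Context: $\mathcal{R}^{(3)}(n,p)$ is the random $3$-uniform hypergraph on $[n]$ in which each $3$-subset is a hyperedge independently with probability $p$. $t_3(n)=\lfloor n^2/4\rfloor$ is the number of edges of the complete balanced bipartite graph on $n$ vertices. A $3$-uniform hypergraph $\mathcal{F}$ on $[n]$ detects a graph $G$ on $[n]$ if some hyperedge of $\mathcal{F}$ spans a triangle in $G$; $\mathcal{F}$ is Turánnical if it detects every graph $G$ on $[n]$ with $e(G)>t_3(n)$.
   Formalization: The parameter p takes only rational values with 0 ≤ p ≤ ½. -}

module Defs where

open import Data.Bool using (Bool; true; false; _∧_; _∨_; if_then_else_)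
open import Data.Nat as ℕ using (ℕ; zero; suc)
open import Data.Nat.DivMod using (_/_)
open import Data.Fin using (Fin; _<?_; _≟_)
open import Data.List using (List; []; _∷_; concatMap; length; all; any; allFin; foldr)
open import Data.Product using (_×_; _,_)
open import Data.Rational as ℚ using (ℚ; 0ℚ; 1ℚ)
open import Relation.Nullary.Decidable using (⌊_⌋)

subsets : {A : Set} → List A → List (List A)
subsets []       = [] ∷ []
subsets (x ∷ xs) = concatMap (λ s → s ∷ (x ∷ s) ∷ []) (subsets xs)

-- 2-subsets {i,j} of [n], written i < j
Pair : ℕ → Set
Pair n = Fin n × Fin n

pairs : (n : ℕ) → List (Pair n)
pairs n = concatMap (λ i → concatMap (λ j →
            if ⌊ i <? j ⌋ then (i , j) ∷ [] else []) (allFin n)) (allFin n)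

-- 3-subsets {i,j,k} of [n], written i < j < k
Triple : ℕ → Set
Triple n = Fin n × Fin n × Fin n

triples : (n : ℕ) → List (Triple n)
triples n = concatMap (λ i → concatMap (λ j → concatMap (λ k →
              if ⌊ i <? j ⌋ ∧ ⌊ j <? k ⌋ then (i , j , k) ∷ [] else [])
              (allFin n)) (allFin n)) (allFin n)

-- a graph on [n] = a set of 2-subsets (a sublist of pairs n)
Graph : ℕ → Set
Graph n = List (Pair n)

-- a 3-uniform hypergraph on [n] = a set of 3-subsets (a sublist of triples n)
Hyp3 : ℕ → Set
Hyp3 n = List (Triple n)

allGraphs : (n : ℕ) → List (Graph n)
allGraphs n = subsets (pairs n)

allHyp3 : (n : ℕ) → List (Hyp3 n)
allHyp3 n = subsets (triples n)

e : {n : ℕ} → Graph n → ℕ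
e G = length G

t3 : ℕ → ℕ
t3 n = (n ℕ.* n) / 4

_∈ᵇ_ : {n : ℕ} → Pair n → Graph n → Bool
(a , b) ∈ᵇ G = any (λ { (c , d) → ⌊ a ≟ c ⌋ ∧ ⌊ b ≟ d ⌋ }) G

spansTriangle : {n : ℕ} → Graph n → Triple n → Bool
spansTriangle G (a , b , c) = ((a , b) ∈ᵇ G) ∧ ((a , c) ∈ᵇ G) ∧ ((b , c) ∈ᵇ G)

detects : {n : ℕ} → Hyp3 n → Graph n → Bool
detects F G = any (spansTriangle G) F

turannical : {n : ℕ} → Hyp3 n → Bool
turannical {n} F = all (λ G → (e G ℕ.≤ᵇ t3 n) ∨ detects F G) (allGraphs n)

_^_ : ℚ → ℕ → ℚ
x ^ zero  = 1ℚ
x ^ suc k = x ℚ.* (x ^ k)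

-- P(R^(3)(n,p) = F) = p^{|F|} (1-p)^{C(n,3) - |F|}
weight : {n : ℕ} → ℚ → Hyp3 n → ℚ
weight {n} p F = (p ^ length F) ℚ.* ((1ℚ ℚ.- p) ^ (length (triples n) ℕ.∸ length F))

probTurannical : ℕ → ℚ → ℚ
probTurannical n p =
  foldr (λ F acc → (if turannical F then weight p F else 0ℚ) ℚ.+ acc) 0ℚ (allHyp3 n)

-- Pair the vertices as {2i, 2i+1} for i < ⌊n/2⌋, and give a triple class i when two of its
-- vertices form the i-th pair. If a hypergraph F has at most ⌈n/2⌉ - 2 triples of class i, then at
-- least ⌊n/2⌋ vertices outside the pair lie in none of them. For a set S of ⌊n/2⌋ such vertices, the
-- complete bipartite graph between S and its complement plus the edge {2i, 2i+1} has
-- ⌊n/2⌋⌈n/2⌉ + 1 > t₃(n) edges, and its only triangles are {2i, 2i+1, w} with w ∈ S, none of which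
-- is in F. So a Turánnical F has at least ⌈n/2⌉ - 1 triples of every class. The classes are disjoint
-- and each has n - 2 triples, so in the random hypergraph the class counts are independent binomials,
-- each reaching ⌈n/2⌉ - 1 with probability at most ¾ when p ≤ ½. Hence the probability of being
-- Turánnical is at most (¾)^⌊n/2⌋ → 0.

module Submission where

open import Data.Nat using (ℕ)

module RationalArithmetic where
  open import Data.Nat using (zero; suc)
  open import Data.Rational
  open import Data.Rational.Properties
  open import Relation.Binary.PropositionalEquality
  open import Relation.Nullary.Decidable.Core using (dec⇒maybe)
  open import Tactic.RingSolver.Core.AlmostCommutativeRing using (AlmostCommutativeRing; fromCommutativeRing)
  open import Defs using (_^_)
  open import Tactic.RingSolver using (solve-∀)

  ℚ-ring : AlmostCommutativeRing _ _
  ℚ-ring = fromCommutativeRing +-*-commutativeRing (λ x → dec⇒maybe (0ℚ ≟ x))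

  0≤1 : 0ℚ ≤ 1ℚ
  0≤1 = ≤ᵇ⇒≤ _

  p≤q⇒0≤q-p : ∀ {p q} → p ≤ q → 0ℚ ≤ q - p
  p≤q⇒0≤q-p {p} {q} p≤q = subst (_≤ q - p) (+-inverseʳ p) (+-monoˡ-≤ (- p) p≤q)

  0≤p*q : ∀ {p q} → 0ℚ ≤ p → 0ℚ ≤ q → 0ℚ ≤ p * q
  0≤p*q {p} 0≤p 0≤q = subst (_≤ p * _) (*-zeroʳ p) (*-monoˡ-≤-nonNeg p {{nonNegative 0≤p}} 0≤q)

  0≤p^k : ∀ {p} → 0ℚ ≤ p → ∀ k → 0ℚ ≤ p ^ k
  0≤p^k 0≤p zero    = 0≤1
  0≤p^k 0≤p (suc k) = 0≤p*q 0≤p (0≤p^k 0≤p k)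

  *-monoˡ-≤-0≤ : ∀ {r p q} → 0ℚ ≤ r → p ≤ q → r * p ≤ r * q
  *-monoˡ-≤-0≤ {r} 0≤r = *-monoˡ-≤-nonNeg r {{nonNegative 0≤r}}

  mix : ℚ → ℚ → ℚ → ℚ
  mix p x y = (1ℚ - p) * x + p * y

  -- Stated unfolded, because the ring solver does not see through mix.
  mix-const : ∀ p z → mix p z z ≡ z
  mix-const = identity
    where identity : ∀ p z → (1ℚ - p) * z + p * z ≡ z
          identity = solve-∀ ℚ-ring

  mix-mono : ∀ {p x y x′ y′} → 0ℚ ≤ p → p ≤ 1ℚ → x ≤ x′ → y ≤ y′ → mix p x y ≤ mix p x′ y′
  mix-mono 0≤p p≤1 x≤x′ y≤y′ = +-mono-≤ (*-monoˡ-≤-0≤ (p≤q⇒0≤q-p p≤1) x≤x′) (*-monoˡ-≤-0≤ 0≤p y≤y′)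

  mix-≤ : ∀ {p x y z} → 0ℚ ≤ p → p ≤ 1ℚ → x ≤ z → y ≤ z → mix p x y ≤ z
  mix-≤ {p} {z = z} 0≤p p≤1 x≤z y≤z = subst (mix p _ _ ≤_) (mix-const p z) (mix-mono 0≤p p≤1 x≤z y≤z)

  ≤-mix : ∀ {p x y z} → 0ℚ ≤ p → p ≤ 1ℚ → z ≤ x → z ≤ y → z ≤ mix p x y
  ≤-mix {p} {z = z} 0≤p p≤1 z≤x z≤y = subst (_≤ mix p _ _) (mix-const p z) (mix-mono 0≤p p≤1 z≤x z≤y)

  mix-monoᵖ : ∀ {p q x y} → p ≤ q → x ≤ y → mix p x y ≤ mix q x y
  mix-monoᵖ {p} {q} {x} {y} p≤q x≤y = subst₂ _≤_ (sym (shift p x y)) (sym (shift q x y))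
    (+-monoʳ-≤ x (*-monoʳ-≤-nonNeg (y - x) {{nonNegative (p≤q⇒0≤q-p x≤y)}} p≤q))
    where shift : ∀ r x y → (1ℚ - r) * x + r * y ≡ x + r * (y - x)
          shift = solve-∀ ℚ-ring

module BinomialTail where
  import Data.Nat as ℕ
  import Data.Nat.Properties as ℕₚ
  open import Data.Nat using (ℕ; zero; suc)
  import Data.Integer as ℤ
  open import Data.Product using (_×_; _,_; proj₁; proj₂)
  open import Data.Rational
  open import Data.Rational.Properties
  open import Relation.Binary.PropositionalEquality
  open import Tactic.RingSolver using (solve-∀)
  open RationalArithmetic

  -- Bin≥ p k t is the probability that at least t of k independent p-biased coins show heads.
  Bin≥ : ℚ → ℕ → ℕ → ℚ
  Bin≥ p _       zero    = 1ℚ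
  Bin≥ p zero    (suc t) = 0ℚ
  Bin≥ p (suc k) (suc t) = mix p (Bin≥ p k (suc t)) (Bin≥ p k t)

  module _ {p : ℚ} (0≤p : 0ℚ ≤ p) (p≤1 : p ≤ 1ℚ) where

    Bin≥-bounds : ∀ k t → 0ℚ ≤ Bin≥ p k t × Bin≥ p k t ≤ 1ℚ
    Bin≥-bounds k       zero    = 0≤1 , ≤-refl
    Bin≥-bounds zero    (suc t) = ≤-refl , 0≤1
    Bin≥-bounds (suc k) (suc t) =
      ≤-mix 0≤p p≤1 (proj₁ (Bin≥-bounds k (suc t))) (proj₁ (Bin≥-bounds k t)) ,
      mix-≤ 0≤p p≤1 (proj₂ (Bin≥-bounds k (suc t))) (proj₂ (Bin≥-bounds k t))

    Bin≥-antitoneᵗ : ∀ k t → Bin≥ p k (suc t) ≤ Bin≥ p k t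
    Bin≥-antitoneᵗ zero    t       = proj₁ (Bin≥-bounds zero t)
    Bin≥-antitoneᵗ (suc k) zero    = proj₂ (Bin≥-bounds (suc k) 1)
    Bin≥-antitoneᵗ (suc k) (suc t) = mix-mono 0≤p p≤1 (Bin≥-antitoneᵗ k (suc t)) (Bin≥-antitoneᵗ k t)

    Bin≥-≤-suc : ∀ k t → Bin≥ p k t ≤ Bin≥ p (suc k) t
    Bin≥-≤-suc k zero    = ≤-refl
    Bin≥-≤-suc k (suc t) = ≤-mix 0≤p p≤1 ≤-refl (Bin≥-antitoneᵗ k t)

    Bin≥-monoᵏ : ∀ t {k k′} → k ℕ.≤ k′ → Bin≥ p k t ≤ Bin≥ p k′ t
    Bin≥-monoᵏ t k≤k′ = go (ℕₚ.≤⇒≤′ k≤k′)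
      where
      go : ∀ {k k′} → k ℕ.≤′ k′ → Bin≥ p k t ≤ Bin≥ p k′ t
      go ℕ.≤′-refl        = ≤-refl
      go (ℕ.≤′-step k≤k′) = ≤-trans (go k≤k′) (Bin≥-≤-suc _ t)

  Bin≥-monoᵖ : ∀ {p q} → 0ℚ ≤ p → p ≤ q → q ≤ 1ℚ → ∀ k t → Bin≥ p k t ≤ Bin≥ q k t
  Bin≥-monoᵖ 0≤p p≤q q≤1 k       zero    = ≤-refl
  Bin≥-monoᵖ 0≤p p≤q q≤1 zero    (suc t) = ≤-refl
  Bin≥-monoᵖ 0≤p p≤q q≤1 (suc k) (suc t) = ≤-trans
    (mix-mono 0≤p (≤-trans p≤q q≤1) (Bin≥-monoᵖ 0≤p p≤q q≤1 k (suc t)) (Bin≥-monoᵖ 0≤p p≤q q≤1 k t))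
    (mix-monoᵖ p≤q (Bin≥-antitoneᵗ (≤-trans 0≤p p≤q) q≤1 k t))

  Bin≥-vanishes : ∀ p {k t} → k ℕ.< t → Bin≥ p k t ≡ 0ℚ
  Bin≥-vanishes p {zero}  {suc t} _ = refl
  Bin≥-vanishes p {suc k} {suc t} (ℕ.s≤s k<t)
    rewrite Bin≥-vanishes p {k} {suc t} (ℕₚ.m<n⇒m<1+n k<t) | Bin≥-vanishes p {k} {t} k<t = mix-const p 0ℚ

  Bin≥-suc : ∀ p k t → Bin≥ p (suc k) t ≡ mix p (Bin≥ p k t) (Bin≥ p k (t ℕ.∸ 1))
  Bin≥-suc p k zero    = sym (mix-const p 1ℚ)
  Bin≥-suc p k (suc t) = refl

  Bin≥-½-complement : ∀ k a b → a ℕ.+ b ≡ suc k → Bin≥ ½ k a + Bin≥ ½ k b ≡ 1ℚ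
  Bin≥-½-complement k zero b refl = cong (1ℚ +_) (Bin≥-vanishes ½ (ℕₚ.n<1+n k))
  Bin≥-½-complement k (suc a) zero a+1≡k+1 with trans (sym (ℕₚ.+-identityʳ a)) (ℕₚ.suc-injective a+1≡k+1)
  ... | refl = trans (+-comm (Bin≥ ½ a (suc a)) 1ℚ) (cong (1ℚ +_) (Bin≥-vanishes ½ (ℕₚ.n<1+n a)))
  Bin≥-½-complement zero (suc a) (suc b) a+b+2≡1 with ℕₚ.suc-injective (trans (sym (ℕₚ.+-suc (suc a) b)) a+b+2≡1)
  ... | ()
  Bin≥-½-complement (suc k) (suc a) (suc b) a+b+2≡k+2 = begin
    mix ½ X Y + mix ½ Z W ≡⟨ regroup X Y Z W ⟩
    ½ * (X + W) + ½ * (Y + Z)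
      ≡⟨ cong₂ (λ u v → ½ * u + ½ * v)
           (Bin≥-½-complement k (suc a) b (trans (sym (ℕₚ.+-suc a b)) a+b+1≡k+1))
           (Bin≥-½-complement k a (suc b) a+b+1≡k+1) ⟩
    ½ * 1ℚ + ½ * 1ℚ ≡⟨⟩
    1ℚ ∎
    where
    open ≡-Reasoning
    X = Bin≥ ½ k (suc a)
    Y = Bin≥ ½ k a
    Z = Bin≥ ½ k (suc b)
    W = Bin≥ ½ k b
    a+b+1≡k+1 : a ℕ.+ suc b ≡ suc k
    a+b+1≡k+1 = ℕₚ.suc-injective a+b+2≡k+2
    regroup : ∀ X Y Z W → ((1ℚ - ½) * X + ½ * Y) + ((1ℚ - ½) * Z + ½ * W) ≡ ½ * (X + W) + ½ * (Y + Z)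
    regroup = solve-∀ ℚ-ring

  Bin≥-½-median : ∀ t → Bin≥ ½ (t ℕ.+ suc t) (suc t) ≡ ½
  Bin≥-½-median t = trans (halve X) (cong (½ *_) (Bin≥-½-complement (t ℕ.+ suc t) (suc t) (suc t) refl))
    where
    X = Bin≥ ½ (t ℕ.+ suc t) (suc t)
    halve : ∀ X → X ≡ ½ * (X + X)
    halve = solve-∀ ℚ-ring

  ¾ : ℚ
  ¾ = ℤ.+ 3 / 4

  Bin≥-≤¾ : ∀ {p} → 0ℚ ≤ p → p ≤ ½ → ∀ {k} t → k ℕ.≤ suc t ℕ.+ suc t → Bin≥ p k (suc t) ≤ ¾
  Bin≥-≤¾ {p} 0≤p p≤½ {k} t k≤2t+2 = begin
    Bin≥ p k (suc t)                       ≤⟨ Bin≥-monoᵏ 0≤p p≤1 (suc t) k≤2t+2 ⟩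
    Bin≥ p (suc t ℕ.+ suc t) (suc t)       ≤⟨ Bin≥-monoᵖ 0≤p p≤½ ½≤1 (suc t ℕ.+ suc t) (suc t) ⟩
    mix ½ (Bin≥ ½ (t ℕ.+ suc t) (suc t)) (Bin≥ ½ (t ℕ.+ suc t) t)
      ≡⟨ cong (λ x → mix ½ x (Bin≥ ½ (t ℕ.+ suc t) t)) (Bin≥-½-median t) ⟩
    mix ½ ½ (Bin≥ ½ (t ℕ.+ suc t) t)
      ≤⟨ +-monoʳ-≤ (½ * ½) (*-monoˡ-≤-0≤ 0≤½ (proj₂ (Bin≥-bounds 0≤½ ½≤1 (t ℕ.+ suc t) t))) ⟩
    mix ½ ½ 1ℚ                             ≡⟨⟩
    ¾                                      ∎
    where
    open ≤-Reasoning
    0≤½ : 0ℚ ≤ ½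
    0≤½ = ≤ᵇ⇒≤ _
    ½≤1 : ½ ≤ 1ℚ
    ½≤1 = ≤ᵇ⇒≤ _
    p≤1 : p ≤ 1ℚ
    p≤1 = ≤-trans p≤½ ½≤1

module RandomSubsets where
  import Data.Nat as ℕ
  import Data.Nat.Properties as ℕₚ
  open import Data.Nat using (ℕ)
  open import Data.Bool using (Bool; true; false; if_then_else_; T)
  open import Data.Empty using (⊥-elim)
  open import Data.List using (List; []; _∷_; length; concatMap; foldr; filterᵇ)
  open import Data.List.Membership.Propositional using (_∈_)
  open import Data.List.Relation.Unary.All using (All; []; _∷_)
  open import Data.List.Relation.Unary.Any using (here; there)
  open import Data.Product using (_×_; _,_; proj₁; proj₂)
  open import Data.Rational
  open import Data.Rational.Properties
  open import Function using (_∘_)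
  open import Relation.Binary.PropositionalEquality
  open import Defs using (subsets; _^_)
  open import Tactic.RingSolver using (solve-∀)
  open RationalArithmetic

  Σℚ : {A : Set} → List A → (A → ℚ) → ℚ
  Σℚ xs f = foldr (λ x acc → f x + acc) 0ℚ xs

  module _ {A : Set} where

    Σℚ-cong : ∀ {P : A → Set} {f g : A → ℚ} {xs} → All P xs → (∀ {x} → P x → f x ≡ g x) →
              Σℚ xs f ≡ Σℚ xs g
    Σℚ-cong []         f≡g = refl
    Σℚ-cong (px ∷ pxs) f≡g = cong₂ _+_ (f≡g px) (Σℚ-cong pxs f≡g)

    Σℚ-mono : ∀ {f g : A → ℚ} xs → (∀ x → f x ≤ g x) → Σℚ xs f ≤ Σℚ xs g
    Σℚ-mono []       f≤g = ≤-refl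
    Σℚ-mono (x ∷ xs) f≤g = +-mono-≤ (f≤g x) (Σℚ-mono xs f≤g)

    Σℚ-mix : ∀ p (f g : A → ℚ) xs → Σℚ xs (λ x → mix p (f x) (g x)) ≡ mix p (Σℚ xs f) (Σℚ xs g)
    Σℚ-mix p f g []       = sym (mix-const p 0ℚ)
    Σℚ-mix p f g (x ∷ xs) = trans (cong (mix p (f x) (g x) +_) (Σℚ-mix p f g xs))
                                  (interchange p (f x) (g x) (Σℚ xs f) (Σℚ xs g))
      where
      interchange : ∀ p u v U V → ((1ℚ - p) * u + p * v) + ((1ℚ - p) * U + p * V)
                                  ≡ (1ℚ - p) * (u + U) + p * (v + V)
      interchange = solve-∀ ℚ-ring

    withAndWithout : A → List (List A) → List (List A)
    withAndWithout x = concatMap (λ s → s ∷ (x ∷ s) ∷ [])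

    Σℚ-withAndWithout : ∀ x (f : List A → ℚ) ss → Σℚ (withAndWithout x ss) f ≡ Σℚ ss (λ s → f s + f (x ∷ s))
    Σℚ-withAndWithout x f []       = refl
    Σℚ-withAndWithout x f (s ∷ ss) = trans (cong (λ r → f s + (f (x ∷ s) + r)) (Σℚ-withAndWithout x f ss))
                                           (sym (+-assoc (f s) (f (x ∷ s)) _))

    All-withAndWithout : ∀ {P Q : List A → Set} x {ss} → All P ss → (∀ {s} → P s → Q s) →
                         (∀ {s} → P s → Q (x ∷ s)) → All Q (withAndWithout x ss)
    All-withAndWithout x []         f g = []
    All-withAndWithout x (ps ∷ pss) f g = f ps ∷ g ps ∷ All-withAndWithout x pss f g

    length-subsets : ∀ (xs : List A) → All (λ s → length s ℕ.≤ length xs) (subsets xs)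
    length-subsets []       = ℕ.z≤n ∷ []
    length-subsets (x ∷ xs) = All-withAndWithout x (length-subsets xs) ℕₚ.m≤n⇒m≤1+n ℕ.s≤s

    ∈-withAndWithout : ∀ x {s ss} → s ∈ ss → s ∈ withAndWithout x ss × (x ∷ s) ∈ withAndWithout x ss
    ∈-withAndWithout x (here refl) = here refl , there (here refl)
    ∈-withAndWithout x (there s∈) = there (there (proj₁ (∈-withAndWithout x s∈))) ,
                                    there (there (proj₂ (∈-withAndWithout x s∈)))

    filterᵇ∈subsets : ∀ (g : A → Bool) xs → filterᵇ g xs ∈ subsets xs
    filterᵇ∈subsets g []       = here refl
    filterᵇ∈subsets g (x ∷ xs) with g x
    ... | true  = proj₂ (∈-withAndWithout x (filterᵇ∈subsets g xs))
    ... | false = proj₁ (∈-withAndWithout x (filterᵇ∈subsets g xs))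

  module _ (p : ℚ) {A : Set} where

    subsetWeight : List A → List A → ℚ
    subsetWeight xs s = (p ^ length s) * ((1ℚ - p) ^ (length xs ℕ.∸ length s))

    Pr : List A → (List A → Bool) → ℚ
    Pr xs g = Σℚ (subsets xs) (λ s → if g s then subsetWeight xs s else 0ℚ)

    Pr-[] : ∀ (g : List A → Bool) → Pr [] g ≡ (if g [] then 1ℚ else 0ℚ)
    Pr-[] g with g []
    ... | true  = refl
    ... | false = refl

    -- The length hypothesis is needed because of truncated subtraction in the exponent.
    subsetWeight-∷-without : ∀ x xs s → length s ℕ.≤ length xs → subsetWeight (x ∷ xs) s ≡ (1ℚ - p) * subsetWeight xs s
    subsetWeight-∷-without x xs s |s|≤|xs| rewrite ℕₚ.+-∸-assoc 1 |s|≤|xs| =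
      swap (p ^ length s) (1ℚ - p) _
      where
      swap : ∀ a b c → a * (b * c) ≡ b * (a * c)
      swap = solve-∀ ℚ-ring

    subsetWeight-∷-with : ∀ x xs s → subsetWeight (x ∷ xs) (x ∷ s) ≡ p * subsetWeight xs s
    subsetWeight-∷-with x xs s = *-assoc p (p ^ length s) _

    Pr-∷ : ∀ x xs (g : List A → Bool) → Pr (x ∷ xs) g ≡ mix p (Pr xs g) (Pr xs (g ∘ (x ∷_)))
    Pr-∷ x xs g = begin
      Pr (x ∷ xs) g                           ≡⟨ Σℚ-withAndWithout x event (subsets xs) ⟩
      Σℚ (subsets xs) (λ s → event s + event (x ∷ s))
        ≡⟨ Σℚ-cong (length-subsets xs) (λ {s} → split s) ⟩
      Σℚ (subsets xs) (λ s → mix p (restrict g s) (restrict (g ∘ (x ∷_)) s))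
        ≡⟨ Σℚ-mix p _ _ (subsets xs) ⟩
      mix p (Pr xs g) (Pr xs (g ∘ (x ∷_)))    ∎
      where
      open ≡-Reasoning
      event : List A → ℚ
      event s = if g s then subsetWeight (x ∷ xs) s else 0ℚ
      restrict : (List A → Bool) → List A → ℚ
      restrict h s = if h s then subsetWeight xs s else 0ℚ
      split : ∀ s → length s ℕ.≤ length xs → event s + event (x ∷ s) ≡ mix p (restrict g s) (restrict (g ∘ (x ∷_)) s)
      split s |s|≤|xs| with g s | g (x ∷ s)
      ... | true  | true  = cong₂ _+_ (subsetWeight-∷-without x xs s |s|≤|xs|) (subsetWeight-∷-with x xs s)
      ... | true  | false = cong₂ _+_ (subsetWeight-∷-without x xs s |s|≤|xs|) (sym (*-zeroʳ p))
      ... | false | true  = cong₂ _+_ (sym (*-zeroʳ (1ℚ - p))) (subsetWeight-∷-with x xs s)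
      ... | false | false = cong₂ _+_ (sym (*-zeroʳ (1ℚ - p))) (sym (*-zeroʳ p))

    module _ (0≤p : 0ℚ ≤ p) (p≤1 : p ≤ 1ℚ) where

      0≤subsetWeight : ∀ xs s → 0ℚ ≤ subsetWeight xs s
      0≤subsetWeight xs s = 0≤p*q (0≤p^k 0≤p (length s)) (0≤p^k (p≤q⇒0≤q-p p≤1) (length xs ℕ.∸ length s))

      Pr-mono : ∀ xs {g h : List A → Bool} → (∀ s → T (g s) → T (h s)) → Pr xs g ≤ Pr xs h
      Pr-mono xs {g} {h} g⇒h = Σℚ-mono (subsets xs) pointwise
        where
        pointwise : ∀ s → (if g s then subsetWeight xs s else 0ℚ) ≤ (if h s then subsetWeight xs s else 0ℚ)
        pointwise s with g s | h s | g⇒h s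
        ... | true  | true  | _   = ≤-refl
        ... | true  | false | imp = ⊥-elim (imp _)
        ... | false | true  | _   = 0≤subsetWeight xs s
        ... | false | false | _   = ≤-refl

module ListCounts where
  open import Data.Nat using (ℕ; _+_; _≡ᵇ_)
  open import Data.Bool using (Bool; if_then_else_)
  open import Data.List using (List; []; _∷_)

  ⟦_⟧ : Bool → ℕ
  ⟦ b ⟧ = if b then 1 else 0

  sumList : {A : Set} → List A → (A → ℕ) → ℕ
  sumList []       f = 0
  sumList (x ∷ xs) f = f x + sumList xs f

  countClass : {A : Set} → (A → ℕ) → ℕ → List A → ℕ
  countClass cls i xs = sumList xs (λ x → ⟦ cls x ≡ᵇ i ⟧)

module IndependentClasses where
  import Data.Nat as ℕ
  import Data.Nat.Properties as ℕₚ
  open import Data.Nat using (ℕ; zero; suc; _≡ᵇ_; _≤ᵇ_)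
  open import Data.Bool using (Bool; true; false; if_then_else_; T; _∧_)
  open import Data.List using (List; []; _∷_)
  open import Data.List.Relation.Unary.All using (universal-U)
  open import Data.Product using (_×_; _,_; proj₁; proj₂)
  import Data.Bool.Properties as Boolₚ
  open import Data.Rational hiding (_≤ᵇ_)
  open import Data.Rational.Properties
  open import Function using (_∘_; Equivalence)
  open import Relation.Binary.PropositionalEquality
  open import Relation.Nullary using (yes; no)
  open import Relation.Nullary.Decidable using (dec-true; dec-false)
  open import Defs using (_^_; subsets)
  open import Tactic.RingSolver using (solve-∀)
  open RationalArithmetic
  open BinomialTail
  open RandomSubsets
  open ListCounts

  ∏< : ℕ → (ℕ → ℚ) → ℚ
  ∏< zero    f = 1ℚ
  ∏< (suc m) f = f m * ∏< m f

  all< : ℕ → (ℕ → Bool) → Bool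
  all< zero    f = true
  all< (suc m) f = f m ∧ all< m f

  all<-intro : ∀ m {f : ℕ → Bool} → (∀ {i} → i ℕ.< m → T (f i)) → T (all< m f)
  all<-intro zero    all-f = _
  all<-intro (suc m) all-f = Equivalence.from Boolₚ.T-∧ (all-f (ℕₚ.n<1+n m) , all<-intro m (all-f ∘ ℕₚ.m<n⇒m<1+n))

  ∏<-cong : ∀ m {f g : ℕ → ℚ} → (∀ {i} → i ℕ.< m → f i ≡ g i) → ∏< m f ≡ ∏< m g
  ∏<-cong zero    f≡g = refl
  ∏<-cong (suc m) f≡g = cong₂ _*_ (f≡g (ℕₚ.n<1+n m)) (∏<-cong m (f≡g ∘ ℕₚ.m<n⇒m<1+n))

  all<-cong : ∀ m {f g : ℕ → Bool} → (∀ i → f i ≡ g i) → all< m f ≡ all< m g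
  all<-cong zero    f≡g = refl
  all<-cong (suc m) f≡g = cong₂ _∧_ (f≡g m) (all<-cong m f≡g)

  ∏<-≤-^ : ∀ m {f : ℕ → ℚ} {c} → 0ℚ ≤ c → (∀ {i} → i ℕ.< m → 0ℚ ≤ f i × f i ≤ c) → ∏< m f ≤ c ^ m
  ∏<-≤-^ zero    0≤c f∈[0,c] = ≤-refl
  ∏<-≤-^ (suc m) {f} {c} 0≤c f∈[0,c] = ≤-trans
    (*-monoˡ-≤-0≤ (proj₁ (f∈[0,c] (ℕₚ.n<1+n m))) (∏<-≤-^ m 0≤c (f∈[0,c] ∘ ℕₚ.m<n⇒m<1+n)))
    (*-monoʳ-≤-nonNeg (c ^ m) {{nonNegative (0≤p^k 0≤c m)}} (proj₂ (f∈[0,c] (ℕₚ.n<1+n m))))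

  ∏<-mix-at : ∀ p m j {f g h : ℕ → ℚ} → (∀ {i} → i ≢ j → f i ≡ h i) → (∀ {i} → i ≢ j → g i ≡ h i) →
              h j ≡ mix p (f j) (g j) → ∏< m h ≡ mix p (∏< m f) (∏< m g)
  ∏<-mix-at p zero    j f≡h g≡h hj = sym (mix-const p 1ℚ)
  ∏<-mix-at p (suc m) j {f} {g} {h} f≡h g≡h hj with m ℕ.≟ j
  ... | yes refl = begin
    h m * ∏< m h                          ≡⟨ cong (_* ∏< m h) hj ⟩
    mix p (f m) (g m) * ∏< m h            ≡⟨ distrib p (f m) (g m) (∏< m h) ⟩
    mix p (f m * ∏< m h) (g m * ∏< m h)   ≡⟨ cong₂ (λ u v → mix p (f m * u) (g m * v))
                                                    (∏<-cong m (λ i<m → sym (f≡h (ℕₚ.<⇒≢ i<m))))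
                                                    (∏<-cong m (λ i<m → sym (g≡h (ℕₚ.<⇒≢ i<m)))) ⟩
    mix p (f m * ∏< m f) (g m * ∏< m g)   ∎
    where
    open ≡-Reasoning
    distrib : ∀ p a b P → ((1ℚ - p) * a + p * b) * P ≡ (1ℚ - p) * (a * P) + p * (b * P)
    distrib = solve-∀ ℚ-ring
  ... | no m≢j = begin
    h m * ∏< m h                          ≡⟨ cong (h m *_) (∏<-mix-at p m j f≡h g≡h hj) ⟩
    h m * mix p (∏< m f) (∏< m g)         ≡⟨ distrib p (h m) (∏< m f) (∏< m g) ⟩
    mix p (h m * ∏< m f) (h m * ∏< m g)   ≡⟨ cong₂ (λ u v → mix p (u * ∏< m f) (v * ∏< m g))
                                                    (sym (f≡h m≢j)) (sym (g≡h m≢j)) ⟩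
    mix p (f m * ∏< m f) (g m * ∏< m g)   ∎
    where
    open ≡-Reasoning
    distrib : ∀ p c P Q → c * ((1ℚ - p) * P + p * Q) ≡ (1ℚ - p) * (c * P) + p * (c * Q)
    distrib = solve-∀ ℚ-ring

  module _ {A : Set} (cls : A → ℕ) (m : ℕ) where

    classCounts≥ : (ℕ → ℕ) → List A → Bool
    classCounts≥ τ s = all< m (λ i → τ i ≤ᵇ countClass cls i s)

    private
      ≡ᵇ-refl : ∀ i → (i ≡ᵇ i) ≡ true
      ≡ᵇ-refl i = dec-true (i ℕ.≟ i) refl

      ≢⇒≡ᵇ-false : ∀ {i j} → i ≢ j → (i ≡ᵇ j) ≡ false
      ≢⇒≡ᵇ-false {i} {j} = dec-false (i ℕ.≟ j)

      lowerAt : A → (ℕ → ℕ) → ℕ → ℕ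
      lowerAt x τ i = if cls x ≡ᵇ i then τ i ℕ.∸ 1 else τ i

      ≤ᵇ-count-∷ : ∀ x τ s i → (τ i ≤ᵇ countClass cls i (x ∷ s)) ≡ (lowerAt x τ i ≤ᵇ countClass cls i s)
      ≤ᵇ-count-∷ x τ s i with cls x ≡ᵇ i | τ i
      ... | false | _             = refl
      ... | true  | zero          = refl
      ... | true  | suc zero      = refl
      ... | true  | suc (suc t)   = refl

      Pr-classCounts≥-[] : ∀ p k (τ : ℕ → ℕ) →
                           (if all< k (λ i → τ i ≤ᵇ 0) then 1ℚ else 0ℚ) ≡ ∏< k (λ i → Bin≥ p 0 (τ i))
      Pr-classCounts≥-[] p zero    τ = refl
      Pr-classCounts≥-[] p (suc k) τ = step (τ k) (Pr-classCounts≥-[] p k τ)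
        where
        step : ∀ v {b P} → (if b then 1ℚ else 0ℚ) ≡ P → (if (v ≤ᵇ 0) ∧ b then 1ℚ else 0ℚ) ≡ Bin≥ p 0 v * P
        step zero    eq = trans eq (sym (*-identityˡ _))
        step (suc v) {P = P} eq = sym (*-zeroˡ P)

    Pr-classCounts≥ : ∀ p xs τ → Pr p xs (classCounts≥ τ) ≡ ∏< m (λ i → Bin≥ p (countClass cls i xs) (τ i))
    Pr-classCounts≥ p []       τ = trans (Pr-[] p (classCounts≥ τ)) (Pr-classCounts≥-[] p m τ)
    Pr-classCounts≥ p (x ∷ xs) τ = begin
      Pr p (x ∷ xs) (classCounts≥ τ)
        ≡⟨ Pr-∷ p x xs (classCounts≥ τ) ⟩
      mix p (Pr p xs (classCounts≥ τ)) (Pr p xs (classCounts≥ τ ∘ (x ∷_)))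
        ≡⟨ cong (mix p _) (Σℚ-cong (universal-U (subsets xs)) (λ {s} _ →
             cong (λ b → if b then subsetWeight p xs s else 0ℚ) (all<-cong m (≤ᵇ-count-∷ x τ s)))) ⟩
      mix p (Pr p xs (classCounts≥ τ)) (Pr p xs (classCounts≥ (lowerAt x τ)))
        ≡⟨ cong₂ (mix p) (Pr-classCounts≥ p xs τ) (Pr-classCounts≥ p xs (lowerAt x τ)) ⟩
      mix p (∏< m without) (∏< m with′)
        ≡⟨ ∏<-mix-at p m (cls x) off-class off-class′ at-class ⟨
      ∏< m (λ i → Bin≥ p (countClass cls i (x ∷ xs)) (τ i)) ∎
      where
      open ≡-Reasoning
      without with′ : ℕ → ℚ
      without i = Bin≥ p (countClass cls i xs) (τ i)
      with′   i = Bin≥ p (countClass cls i xs) (lowerAt x τ i)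
      off-class : ∀ {i} → i ≢ cls x → without i ≡ Bin≥ p (countClass cls i (x ∷ xs)) (τ i)
      off-class i≢j rewrite ≢⇒≡ᵇ-false (i≢j ∘ sym) = refl
      off-class′ : ∀ {i} → i ≢ cls x → with′ i ≡ Bin≥ p (countClass cls i (x ∷ xs)) (τ i)
      off-class′ i≢j rewrite ≢⇒≡ᵇ-false (i≢j ∘ sym) = refl
      at-class : Bin≥ p (countClass cls (cls x) (x ∷ xs)) (τ (cls x)) ≡ mix p (without (cls x)) (with′ (cls x))
      at-class rewrite ≡ᵇ-refl (cls x) = Bin≥-suc p (countClass cls (cls x) xs) (τ (cls x))

module FinSums where
  import Data.Nat as ℕ
  import Data.Nat.Properties as ℕₚ
  open import Data.Nat using (ℕ; zero; suc; _+_; _*_; _≤_; z≤n)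
  open import Data.Bool using (Bool; true; false; not; if_then_else_; T; _∧_; _xor_)
  open import Data.Empty using (⊥-elim)
  open import Data.Fin using (Fin; zero; suc; toℕ; _≟_; _<?_; _<_)
  open import Data.List using (List; []; _∷_; _++_; concatMap; allFin; tabulate; filterᵇ; length)
  open import Data.Product using (Σ-syntax; _×_; _,_)
  open import Relation.Binary.PropositionalEquality
  open import Relation.Nullary using (does; yes; no)
  open import Relation.Nullary.Decidable using (⌊_⌋; dec-true; dec-false; isYes≗does)
  open import Defs using (Pair; pairs; Triple; triples)
  open import Algebra.Properties.CommutativeMonoid.Sum ℕₚ.+-0-commutativeMonoid
    using (sum; sum-syntax; ∑-distrib-+; sum-cong-≗; sum-replicate-zero) public
  open ListCounts using (⟦_⟧; sumList)
  import Data.Bool.Properties as Boolₚ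
  import Data.Vec.Functional as V
  open import Function using (_∘_; Equivalence)
  open import Relation.Nullary using (¬_)

  eqᵇ : ∀ {n} → Fin n → Fin n → Bool
  eqᵇ a b = does (a ≟ b)

  ltᵇ : ∀ {n} → Fin n → Fin n → Bool
  ltᵇ a b = toℕ a ℕ.<ᵇ toℕ b

  eqᵇ-refl : ∀ {n} (a : Fin n) → eqᵇ a a ≡ true
  eqᵇ-refl a = dec-true (a ≟ a) refl

  eqᵇ-sound : ∀ {n} {a b : Fin n} → T (eqᵇ a b) → a ≡ b
  eqᵇ-sound {a = a} {b} eq with a ≟ b
  ... | yes a≡b = a≡b
  ... | no  _   = ⊥-elim eq

  eqᵇ-≢ : ∀ {n} {a b : Fin n} → a ≢ b → eqᵇ a b ≡ false
  eqᵇ-≢ {a = a} {b} = dec-false (a ≟ b)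

  eqᵇ-complete : ∀ {n} {a b : Fin n} → a ≡ b → T (eqᵇ a b)
  eqᵇ-complete {a = a} refl = Equivalence.from Boolₚ.T-≡ (eqᵇ-refl a)

  ltᵇ-sound : ∀ {n} (a b : Fin n) → ltᵇ a b ≡ true → a < b
  ltᵇ-sound a b = ℕₚ.<ᵇ⇒< (toℕ a) (toℕ b) ∘ Equivalence.from Boolₚ.T-≡

  ltᵇ-true : ∀ {n} {a b : Fin n} → a < b → ltᵇ a b ≡ true
  ltᵇ-true {a = a} {b} = dec-true (toℕ a ℕ.<? toℕ b)

  ltᵇ-false : ∀ {n} {a b : Fin n} → ¬ a < b → ltᵇ a b ≡ false
  ltᵇ-false {a = a} {b} = dec-false (toℕ a ℕ.<? toℕ b)

  sum-mono : ∀ n {f g : Fin n → ℕ} → (∀ w → f w ≤ g w) → sum f ≤ sum g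
  sum-mono zero    f≤g = z≤n
  sum-mono (suc n) f≤g = ℕₚ.+-mono-≤ (f≤g zero) (sum-mono n (λ w → f≤g (suc w)))

  sum-zero : ∀ n {f : Fin n → ℕ} → (∀ w → f w ≡ 0) → sum f ≡ 0
  sum-zero n f≡0 = trans (sum-cong-≗ f≡0) (sum-replicate-zero n)

  sum-one : ∀ n → ∑[ w < n ] 1 ≡ n
  sum-one zero    = refl
  sum-one (suc n) = cong suc (sum-one n)

  sum-at : ∀ n (c : Fin n) (f : Fin n → ℕ) → ∑[ w < n ] (if eqᵇ w c then f w else 0) ≡ f c
  sum-at (suc n) zero    f = trans (cong (f zero +_) (sum-zero n (λ _ → refl))) (ℕₚ.+-identityʳ (f zero))
  sum-at (suc n) (suc c) f = sum-at n c (λ w → f (suc w))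

  ∑-distrib-+₄ : ∀ n (f g h k : Fin n → ℕ) → ∑[ w < n ] (f w + g w + h w + k w) ≡ sum f + sum g + sum h + sum k
  ∑-distrib-+₄ n f g h k =
    trans (∑-distrib-+ {n} _ k) (cong (_+ sum k) (trans (∑-distrib-+ {n} _ h) (cong (_+ sum h) (∑-distrib-+ {n} f g))))

  sum-if : ∀ n b (f : Fin n → ℕ) → ∑[ w < n ] (if b then f w else 0) ≡ (if b then sum f else 0)
  sum-if n true  f = refl
  sum-if n false f = sum-zero n (λ _ → refl)

  sum-⟦eqᵇ⟧ : ∀ n (c : Fin n) → ∑[ w < n ] ⟦ eqᵇ w c ⟧ ≡ 1
  sum-⟦eqᵇ⟧ n c = sum-at n c (λ _ → 1)

  count : ∀ n → (Fin n → Bool) → ℕ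
  count n P = ∑[ w < n ] ⟦ P w ⟧

  count+count-not : ∀ n (P : Fin n → Bool) → count n P + count n (λ w → not (P w)) ≡ n
  count+count-not zero    P = refl
  count+count-not (suc n) P with P zero
  ... | true  = cong suc (count+count-not n (λ w → P (suc w)))
  ... | false = trans (ℕₚ.+-suc _ _) (cong suc (count+count-not n (λ w → P (suc w))))

  choose : ∀ n (P : Fin n → Bool) k → k ≤ count n P →
           Σ[ S ∈ (Fin n → Bool) ] ((∀ {w} → T (S w) → T (P w)) × count n S ≡ k)
  choose n       P zero    _ = (λ _ → false) , (λ ()) , sum-zero n (λ _ → refl)
  choose (suc n) P (suc k) k<count with P zero in P0
  ... | true with choose n (λ w → P (suc w)) k (ℕₚ.≤-pred k<count)
  ...   | S , S⊆P , |S| = (true V.∷ S) , (λ { {zero} _ → Equivalence.from Boolₚ.T-≡ P0 ; {suc w} → S⊆P }) , cong suc |S|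
  choose (suc n) P (suc k) k<count | false with choose n (λ w → P (suc w)) (suc k) k<count
  ...   | S , S⊆P , |S| = (false V.∷ S) , (λ { {zero} () ; {suc w} → S⊆P }) , |S|

  sumList-++ : {A : Set} (xs ys : List A) (f : A → ℕ) → sumList (xs ++ ys) f ≡ sumList xs f + sumList ys f
  sumList-++ []       ys f = refl
  sumList-++ (x ∷ xs) ys f = trans (cong (f x +_) (sumList-++ xs ys f)) (sym (ℕₚ.+-assoc (f x) _ _))

  sumList-concatMap : {A B : Set} (g : A → List B) (xs : List A) (f : B → ℕ) →
                      sumList (concatMap g xs) f ≡ sumList xs (λ x → sumList (g x) f)
  sumList-concatMap g []       f = refl
  sumList-concatMap g (x ∷ xs) f =
    trans (sumList-++ (g x) (concatMap g xs) f) (cong (sumList (g x) f +_) (sumList-concatMap g xs f))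

  sumList-allFin : ∀ n (f : Fin n → ℕ) → sumList (allFin n) f ≡ sum f
  sumList-allFin n f = go n (λ w → w)
    where
    go : ∀ k (g : Fin k → Fin n) → sumList (tabulate g) f ≡ ∑[ w < k ] f (g w)
    go zero    g = refl
    go (suc k) g = cong (f (g zero) +_) (go k (λ w → g (suc w)))

  sumList-pairs : ∀ n (f : Pair n → ℕ) →
                  sumList (pairs n) f ≡ ∑[ a < n ] ∑[ b < n ] (if ltᵇ a b then f (a , b) else 0)
  sumList-pairs n f =
    trans (sumList-concatMap _ (allFin n) f) (trans (sumList-allFin n _) (sum-cong-≗ λ a →
    trans (sumList-concatMap _ (allFin n) f) (trans (sumList-allFin n _) (sum-cong-≗ λ b → entry a b))))
    where
    entry : ∀ a b → sumList (if ⌊ a <? b ⌋ then (a , b) ∷ [] else []) f ≡ (if ltᵇ a b then f (a , b) else 0)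
    entry a b rewrite isYes≗does (a <? b) with ltᵇ a b
    ... | true  = ℕₚ.+-identityʳ _
    ... | false = refl

  sumList-triples : ∀ n (f : Triple n → ℕ) →
                    sumList (triples n) f ≡ ∑[ a < n ] ∑[ b < n ] ∑[ c < n ] (if ltᵇ a b ∧ ltᵇ b c then f (a , b , c) else 0)
  sumList-triples n f =
    trans (sumList-concatMap _ (allFin n) f) (trans (sumList-allFin n _) (sum-cong-≗ λ a →
    trans (sumList-concatMap _ (allFin n) f) (trans (sumList-allFin n _) (sum-cong-≗ λ b →
    trans (sumList-concatMap _ (allFin n) f) (trans (sumList-allFin n _) (sum-cong-≗ λ c → entry a b c))))))
    where
    entry : ∀ a b c → sumList (if ⌊ a <? b ⌋ ∧ ⌊ b <? c ⌋ then (a , b , c) ∷ [] else []) f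
                      ≡ (if ltᵇ a b ∧ ltᵇ b c then f (a , b , c) else 0)
    entry a b c rewrite isYes≗does (a <? b) | isYes≗does (b <? c) with ltᵇ a b ∧ ltᵇ b c
    ... | true  = ℕₚ.+-identityʳ _
    ... | false = refl

  length-filterᵇ : {A : Set} (g : A → Bool) (xs : List A) → length (filterᵇ g xs) ≡ sumList xs (λ x → ⟦ g x ⟧)
  length-filterᵇ g []       = refl
  length-filterᵇ g (x ∷ xs) with g x
  ... | true  = cong suc (length-filterᵇ g xs)
  ... | false = length-filterᵇ g xs

  crossings : ∀ n → (Fin n → Bool) → ℕ
  crossings n S = ∑[ a < n ] ∑[ b < n ] ⟦ ltᵇ a b ∧ (S a xor S b) ⟧

  crossings≡ : ∀ n (S : Fin n → Bool) → crossings n S ≡ count n S * count n (λ w → not (S w))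
  crossings≡ zero    S = refl
  crossings≡ (suc n) S rewrite crossings≡ n (λ w → S (suc w)) with S zero
  ... | true  = refl
  ... | false = sym (ℕₚ.*-suc (count n (λ w → S (suc w))) _)

module RepeatedValue where
  import Data.Nat.Properties as ℕₚ
  open import Data.Nat using (ℕ; _≡ᵇ_)
  open import Data.Bool using (true; false; if_then_else_; T)
  open import Data.Empty using (⊥-elim)
  open import Data.Product using (_×_; _,_)
  open import Data.Sum using (_⊎_; inj₁; inj₂)
  import Data.Bool.Properties as Boolₚ
  open import Function using (_∘_; Equivalence)
  open import Relation.Binary.PropositionalEquality

  repeated : ℕ → ℕ → ℕ → ℕ → ℕ
  repeated x y z d = if x ≡ᵇ y then x else if y ≡ᵇ z then y else if x ≡ᵇ z then x else d

  TwoOf : ℕ → ℕ → ℕ → ℕ → Set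
  TwoOf x y z i = (x ≡ i × y ≡ i) ⊎ (y ≡ i × z ≡ i) ⊎ (x ≡ i × z ≡ i)

  private
    ≡ᵇ-true : ∀ {x y} → (x ≡ᵇ y) ≡ true → x ≡ y
    ≡ᵇ-true {x} {y} = ℕₚ.≡ᵇ⇒≡ x y ∘ Equivalence.from Boolₚ.T-≡

    ≡ᵇ-false : ∀ {x y} → (x ≡ᵇ y) ≡ false → x ≢ y
    ≡ᵇ-false {x} {y} eq = subst T eq ∘ ℕₚ.≡⇒≡ᵇ x y

  repeated-≡ : ∀ x y z d {i} → TwoOf x y z i → repeated x y z d ≡ i
  repeated-≡ x y z d two with x ≡ᵇ y in x=y | y ≡ᵇ z in y=z | x ≡ᵇ z in x=z | two
  ... | true  | _     | _     | inj₁ (x≡i , _)        = x≡i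
  ... | true  | _     | _     | inj₂ (inj₁ (y≡i , _)) = trans (≡ᵇ-true x=y) y≡i
  ... | true  | _     | _     | inj₂ (inj₂ (x≡i , _)) = x≡i
  ... | false | true  | _     | inj₁ (_ , y≡i)        = y≡i
  ... | false | true  | _     | inj₂ (inj₁ (y≡i , _)) = y≡i
  ... | false | true  | _     | inj₂ (inj₂ (_ , z≡i)) = trans (≡ᵇ-true y=z) z≡i
  ... | false | false | true  | inj₁ (x≡i , _)        = x≡i
  ... | false | false | true  | inj₂ (inj₁ (y≡i , z≡i)) = ⊥-elim (≡ᵇ-false y=z (trans y≡i (sym z≡i)))
  ... | false | false | true  | inj₂ (inj₂ (x≡i , _)) = x≡i
  ... | false | false | false | inj₁ (x≡i , y≡i)        = ⊥-elim (≡ᵇ-false x=y (trans x≡i (sym y≡i)))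
  ... | false | false | false | inj₂ (inj₁ (y≡i , z≡i)) = ⊥-elim (≡ᵇ-false y=z (trans y≡i (sym z≡i)))
  ... | false | false | false | inj₂ (inj₂ (x≡i , z≡i)) = ⊥-elim (≡ᵇ-false x=z (trans x≡i (sym z≡i)))

  repeated-TwoOf : ∀ {x y z d i} → repeated x y z d ≡ i → i ≢ d → TwoOf x y z i
  repeated-TwoOf {x} {y} {z} rep≡i i≢d with x ≡ᵇ y in x=y | y ≡ᵇ z in y=z | x ≡ᵇ z in x=z
  ... | true  | _     | _     = inj₁ (rep≡i , trans (sym (≡ᵇ-true x=y)) rep≡i)
  ... | false | true  | _     = inj₂ (inj₁ (rep≡i , trans (sym (≡ᵇ-true y=z)) rep≡i))
  ... | false | false | true  = inj₂ (inj₂ (rep≡i , trans (sym (≡ᵇ-true x=z)) rep≡i))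
  ... | false | false | false = ⊥-elim (i≢d (sym rep≡i))

module Halving where
  import Data.Nat.Properties as ℕₚ
  open import Data.Nat using (zero; suc; _+_; _*_; _≤_; _<_; ⌊_/2⌋; ⌈_/2⌉)
  open import Data.Nat.DivMod using (m<n*o⇒m/o<n)
  open import Data.Nat.Tactic.RingSolver using (solve-∀)
  open import Data.Sum using (_⊎_; inj₁; inj₂)
  open import Function using (_∘_)
  open import Relation.Binary.PropositionalEquality
  open import Defs using (t3)

  ⌊1+n+n/2⌋≡n : ∀ m → ⌊ suc (m + m) /2⌋ ≡ m
  ⌊1+n+n/2⌋≡n zero    = refl
  ⌊1+n+n/2⌋≡n (suc m) rewrite ℕₚ.+-suc m m = cong suc (⌊1+n+n/2⌋≡n m)

  even⊎odd : ∀ k → k ≡ ⌊ k /2⌋ + ⌊ k /2⌋ ⊎ k ≡ suc (⌊ k /2⌋ + ⌊ k /2⌋)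
  even⊎odd zero          = inj₁ refl
  even⊎odd (suc zero)    = inj₂ refl
  even⊎odd (suc (suc k)) rewrite ℕₚ.+-suc ⌊ k /2⌋ ⌊ k /2⌋ with even⊎odd k
  ... | inj₁ eq = inj₁ (cong (suc ∘ suc) eq)
  ... | inj₂ eq = inj₂ (cong (suc ∘ suc) eq)

  ⌊k/2⌋≡m⇒ : ∀ k {m} → ⌊ k /2⌋ ≡ m → k ≡ m + m ⊎ k ≡ suc (m + m)
  ⌊k/2⌋≡m⇒ k refl = even⊎odd k

  ⌊n/2⌋+⌊n/2⌋≤n : ∀ n → ⌊ n /2⌋ + ⌊ n /2⌋ ≤ n
  ⌊n/2⌋+⌊n/2⌋≤n n =
    subst (⌊ n /2⌋ + ⌊ n /2⌋ ≤_) (ℕₚ.⌊n/2⌋+⌈n/2⌉≡n n) (ℕₚ.+-monoʳ-≤ ⌊ n /2⌋ (ℕₚ.⌊n/2⌋≤⌈n/2⌉ n))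

  n≤⌈n/2⌉+⌈n/2⌉ : ∀ n → n ≤ ⌈ n /2⌉ + ⌈ n /2⌉
  n≤⌈n/2⌉+⌈n/2⌉ n =
    subst (_≤ ⌈ n /2⌉ + ⌈ n /2⌉) (ℕₚ.⌊n/2⌋+⌈n/2⌉≡n n) (ℕₚ.+-monoˡ-≤ ⌈ n /2⌉ (ℕₚ.⌊n/2⌋≤⌈n/2⌉ n))

  i<⌊n/2⌋⇒2i+1<n : ∀ {i n} → i < ⌊ n /2⌋ → suc (i + i) < n
  i<⌊n/2⌋⇒2i+1<n {i} {n} i<⌊n/2⌋ = ℕₚ.≤-trans (ℕₚ.≤-reflexive (cong suc (sym (ℕₚ.+-suc i i))))
                                       (ℕₚ.≤-trans (ℕₚ.+-mono-≤ i<⌊n/2⌋ i<⌊n/2⌋) (⌊n/2⌋+⌊n/2⌋≤n n))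

  t3≤⌊n/2⌋*⌈n/2⌉ : ∀ n → t3 n ≤ ⌊ n /2⌋ * ⌈ n /2⌉
  t3≤⌊n/2⌋*⌈n/2⌉ n = ℕₚ.≤-pred (m<n*o⇒m/o<n (square< n (even⊎odd n)))
    where
    square< : ∀ n → n ≡ ⌊ n /2⌋ + ⌊ n /2⌋ ⊎ n ≡ suc (⌊ n /2⌋ + ⌊ n /2⌋) →
              n * n < suc (⌊ n /2⌋ * ⌈ n /2⌉) * 4
    square< n (inj₁ even) rewrite even | sym (ℕₚ.n≡⌊n+n/2⌋ ⌊ n /2⌋) | ⌊1+n+n/2⌋≡n ⌊ n /2⌋ =
      subst (suc ((⌊ n /2⌋ + ⌊ n /2⌋) * (⌊ n /2⌋ + ⌊ n /2⌋)) ≤_) (expand ⌊ n /2⌋) (ℕₚ.m≤m+n _ 3)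
      where expand : ∀ f → suc ((f + f) * (f + f)) + 3 ≡ suc (f * f) * 4
            expand = solve-∀
    square< n (inj₂ odd) rewrite odd | ⌊1+n+n/2⌋≡n ⌊ n /2⌋ | sym (ℕₚ.n≡⌊n+n/2⌋ ⌊ n /2⌋) =
      subst (suc (suc (⌊ n /2⌋ + ⌊ n /2⌋) * suc (⌊ n /2⌋ + ⌊ n /2⌋)) ≤_) (expand ⌊ n /2⌋) (ℕₚ.m≤m+n _ 2)
      where expand : ∀ f → suc (suc (f + f) * suc (f + f)) + 2 ≡ suc (f * suc f) * 4
            expand = solve-∀

module PairClasses (n : ℕ) where
  import Data.Nat.Properties as ℕₚ
  open import Data.Nat using (ℕ; suc; _+_; _*_; _≤_; _<_; _≡ᵇ_; _≤ᵇ_; _≤?_; z≤n; s≤s; ⌊_/2⌋; ⌈_/2⌉)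
  open import Data.Bool using (Bool; true; false; T; not; _∧_; _∨_; _xor_; if_then_else_; T?)
  open import Data.Bool.ListAction using (any)
  import Data.Bool.Properties as Boolₚ
  open import Data.Empty using (⊥; ⊥-elim)
  open import Data.Fin using (Fin; toℕ; fromℕ<; _≟_)
  open import Data.Fin.Properties using (toℕ-fromℕ<; toℕ-injective)
  open import Data.List using ([]; _∷_; filterᵇ)
  open import Data.Product as Prod using (Σ-syntax; _×_; _,_; proj₁; proj₂)
  open import Data.Sum as Sum using (_⊎_; inj₁; inj₂; [_,_])
  open import Function using (_∘_; id; Equivalence)
  open import Relation.Binary.PropositionalEquality hiding ([_])
  open import Relation.Binary using (tri<; tri≈; tri>)
  open import Relation.Nullary using (¬_; yes; no)
  open import Relation.Nullary.Decidable using (_×-dec_; toWitness)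
  open import Data.List.Membership.Propositional using (find; lose)
  open import Data.List.Membership.Propositional.Properties using (∈-filter⁻)
  import Data.List.Relation.Unary.All as All
  open import Data.List.Relation.Unary.All.Properties using (all⁺)
  open import Data.List.Relation.Unary.Any.Properties using (any⁺; any⁻)
  open import Defs using (Pair; pairs; Triple; triples; Hyp3; Graph; e; t3; _∈ᵇ_; detects; turannical; allGraphs)
  open ListCounts
  open FinSums
  open RepeatedValue
  open Halving

  pairOf : Fin n → ℕ
  pairOf w = ⌊ toℕ w /2⌋

  -- Class i < ⌊n/2⌋ when two vertices lie in pair i; the value n marks the triples in no class.
  classOf : Triple n → ℕ
  classOf (a , b , c) = repeated (pairOf a) (pairOf b) (pairOf c) n

  classOf-≡ : ∀ a b c {i} → TwoOf (pairOf a) (pairOf b) (pairOf c) i → classOf (a , b , c) ≡ i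
  classOf-≡ a b c = repeated-≡ (pairOf a) (pairOf b) (pairOf c) n

  contains : Fin n → Triple n → Bool
  contains w (a , b , c) = eqᵇ w a ∨ eqᵇ w b ∨ eqᵇ w c

  contains-∈ : ∀ {w a b c} → T (contains w (a , b , c)) → w ≡ a ⊎ w ≡ b ⊎ w ≡ c
  contains-∈ {w} {a} = Sum.map (eqᵇ-sound {a = w} {a}) (Sum.map eqᵇ-sound eqᵇ-sound ∘ Equivalence.to Boolₚ.T-∨) ∘
                       Equivalence.to Boolₚ.T-∨

  ∈-contains : ∀ w a b c → w ≡ a ⊎ w ≡ b ⊎ w ≡ c → T (contains w (a , b , c))
  ∈-contains _ _ _ _ = Equivalence.from Boolₚ.T-∨ ∘
               Sum.map eqᵇ-complete (Equivalence.from Boolₚ.T-∨ ∘ Sum.map eqᵇ-complete eqᵇ-complete)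

  module VertexPair (i : ℕ) (2i+1<n : suc (i + i) < n) where

    2i<n : i + i < n
    2i<n = ℕₚ.<-trans (ℕₚ.n<1+n (i + i)) 2i+1<n

    i≢n : i ≢ n
    i≢n = ℕₚ.<⇒≢ (ℕₚ.≤-<-trans (ℕₚ.m≤m+n i i) 2i<n)

    u v : Fin n
    u = fromℕ< 2i<n
    v = fromℕ< 2i+1<n

    toℕ-u : toℕ u ≡ i + i
    toℕ-u = toℕ-fromℕ< 2i<n

    toℕ-v : toℕ v ≡ suc (i + i)
    toℕ-v = toℕ-fromℕ< 2i+1<n

    pairOf-u : pairOf u ≡ i
    pairOf-u rewrite toℕ-u = sym (ℕₚ.n≡⌊n+n/2⌋ i)

    pairOf-v : pairOf v ≡ i
    pairOf-v rewrite toℕ-v = ⌊1+n+n/2⌋≡n i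

    u≢v : u ≢ v
    u≢v u≡v = ℕₚ.<⇒≢ (ℕₚ.n<1+n (i + i)) (trans (sym toℕ-u) (trans (cong toℕ u≡v) toℕ-v))

    v≡1+u : toℕ v ≡ suc (toℕ u)
    v≡1+u = trans toℕ-v (cong suc (sym toℕ-u))

    u<v : toℕ u < toℕ v
    u<v = subst (toℕ u <_) (sym v≡1+u) (ℕₚ.n<1+n (toℕ u))

    u<ᵇv : ltᵇ u v ≡ true
    u<ᵇv = ltᵇ-true u<v

    InPair : Fin n → Set
    InPair x = x ≡ u ⊎ x ≡ v

    pairOf≡i⇒InPair : ∀ {x} → pairOf x ≡ i → InPair x
    pairOf≡i⇒InPair {x} pairOf-x with ⌊k/2⌋≡m⇒ (toℕ x) pairOf-x
    ... | inj₁ eq = inj₁ (toℕ-injective (trans eq (sym toℕ-u)))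
    ... | inj₂ eq = inj₂ (toℕ-injective (trans eq (sym toℕ-v)))

    outside : Fin n → Bool
    outside w = not (eqᵇ w u) ∧ not (eqᵇ w v)

    neither : ∀ {w x y z : Fin n} → w ≢ x → w ≢ y → w ≡ x ⊎ w ≡ y ⊎ w ≡ z → w ≡ z
    neither w≢x w≢y = [ ⊥-elim ∘ w≢x , [ ⊥-elim ∘ w≢y , id ] ]

    outside⇒≢ : ∀ {w x} → T (outside w) → InPair x → w ≢ x
    outside⇒≢ {w} out (inj₁ refl) refl rewrite eqᵇ-refl u = out
    outside⇒≢ {w} out (inj₂ refl) refl rewrite eqᵇ-refl v with eqᵇ v u
    ... | true  = out
    ... | false = out

    outside⇒≢pairOf : ∀ {w x} → T (outside w) → pairOf x ≡ i → w ≢ x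
    outside⇒≢pairOf out pairOf-x = outside⇒≢ out (pairOf≡i⇒InPair pairOf-x)

    -- A triple of class i has two vertices in the pair, so at most one vertex outside it.
    class-i-third : ∀ t → classOf t ≡ i → Σ[ x ∈ Fin n ] (∀ {w} → T (outside w) → T (contains w t) → w ≡ x)
    class-i-third (a , b , c) class≡i with repeated-TwoOf class≡i i≢n
    ... | inj₁ (a∈ , b∈)        = c , λ {w} out w∈ → neither (outside⇒≢pairOf out a∈) (outside⇒≢pairOf out b∈)
                                                    (contains-∈ {w} {a} {b} {c} w∈)
    ... | inj₂ (inj₁ (b∈ , c∈)) = a , λ {w} out w∈ → neither (outside⇒≢pairOf out b∈) (outside⇒≢pairOf out c∈)
                                                    ([ inj₂ ∘ inj₂ , Sum.map₂ inj₁ ] (contains-∈ {w} {a} {b} {c} w∈))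
    ... | inj₂ (inj₂ (a∈ , c∈)) = b , λ {w} out w∈ → neither (outside⇒≢pairOf out a∈) (outside⇒≢pairOf out c∈)
                                                    (Sum.map₂ Sum.swap (contains-∈ {w} {a} {b} {c} w∈))

    hitBy : Hyp3 n → Fin n → Bool
    hitBy F w = any (λ t → (classOf t ≡ᵇ i) ∧ contains w t) F

    free : Hyp3 n → Fin n → Bool
    free F w = not (hitBy F w) ∧ outside w

    private
      ⟦⟧-mono : ∀ {a b} → (T a → T b) → ⟦ a ⟧ ≤ ⟦ b ⟧
      ⟦⟧-mono {false}         a⇒b = z≤n
      ⟦⟧-mono {true}  {true}  a⇒b = ℕₚ.≤-refl
      ⟦⟧-mono {true}  {false} a⇒b = ⊥-elim (a⇒b _)

      ⟦∨∧⟧≤ : ∀ a b c → ⟦ (a ∨ b) ∧ c ⟧ ≤ ⟦ a ∧ c ⟧ + ⟦ b ∧ c ⟧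
      ⟦∨∧⟧≤ true  b true  = s≤s z≤n
      ⟦∨∧⟧≤ false b true  = ℕₚ.≤-refl
      ⟦∨∧⟧≤ true  b false = z≤n
      ⟦∨∧⟧≤ false b false rewrite Boolₚ.∧-zeroʳ b = z≤n

      ⟦∧∨false⟧ : ∀ a b → ⟦ a ∧ b ⟧ + 0 ≤ (if a then ⟦ b ∨ false ⟧ else 0)
      ⟦∧∨false⟧ true  b rewrite ℕₚ.+-identityʳ ⟦ b ⟧ | Boolₚ.∨-identityʳ b = ℕₚ.≤-refl
      ⟦∧∨false⟧ false b = z≤n

      exactly-one : ∀ h a b → 1 ≤ ⟦ not h ∧ not a ∧ not b ⟧ + ⟦ h ∧ not a ∧ not b ⟧ + ⟦ a ⟧ + ⟦ b ⟧
      exactly-one false false false = s≤s z≤n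
      exactly-one false false true  = s≤s z≤n
      exactly-one false true  false = s≤s z≤n
      exactly-one false true  true  = s≤s z≤n
      exactly-one true  false false = s≤s z≤n
      exactly-one true  false true  = s≤s z≤n
      exactly-one true  true  false = s≤s z≤n
      exactly-one true  true  true  = s≤s z≤n

    count-hit-outside : ∀ F → count n (λ w → hitBy F w ∧ outside w) ≤ countClass classOf i F
    count-hit-outside []      = ℕₚ.≤-reflexive (sum-zero n (λ _ → refl))
    count-hit-outside (t ∷ F) = begin
      count n (λ w → hitBy (t ∷ F) w ∧ outside w)
        ≤⟨ sum-mono n (λ w → ⟦∨∧⟧≤ ((classOf t ≡ᵇ i) ∧ contains w t) (hitBy F w) (outside w)) ⟩
      ∑[ w < n ] (⟦ ((classOf t ≡ᵇ i) ∧ contains w t) ∧ outside w ⟧ + ⟦ hitBy F w ∧ outside w ⟧)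
        ≡⟨ ∑-distrib-+ {n} _ _ ⟩
      count n (λ w → ((classOf t ≡ᵇ i) ∧ contains w t) ∧ outside w) + count n (λ w → hitBy F w ∧ outside w)
        ≤⟨ ℕₚ.+-mono-≤ (at-most-one (classOf t ≡ᵇ i) (ℕₚ.≡ᵇ⇒≡ (classOf t) i)) (count-hit-outside F) ⟩
      ⟦ classOf t ≡ᵇ i ⟧ + countClass classOf i F ∎
      where
      open ℕₚ.≤-Reasoning
      at-most-one : ∀ c → (T c → classOf t ≡ i) → count n (λ w → (c ∧ contains w t) ∧ outside w) ≤ ⟦ c ⟧
      at-most-one false _     = ℕₚ.≤-reflexive (sum-zero n (λ _ → refl))
      at-most-one true  class with class-i-third t (class _)
      ... | x , only-x = begin
        count n (λ w → contains w t ∧ outside w) ≤⟨ sum-mono n (λ w → ⟦⟧-mono (is-x w)) ⟩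
        ∑[ w < n ] ⟦ eqᵇ w x ⟧                    ≡⟨ sum-⟦eqᵇ⟧ n x ⟩
        1                                        ∎
        where
        is-x : ∀ w → T (contains w t ∧ outside w) → T (eqᵇ w x)
        is-x w w∈∧out = let w∈ , out = Equivalence.to (Boolₚ.T-∧ {contains w t}) w∈∧out in
          eqᵇ-complete (only-x {w} out w∈)

    n≤free+class+2 : ∀ F → n ≤ count n (free F) + countClass classOf i F + 2
    n≤free+class+2 F = begin
      n                   ≡⟨ sum-one n ⟨
      ∑[ w < n ] 1        ≤⟨ sum-mono n (λ w → exactly-one (hitBy F w) (eqᵇ w u) (eqᵇ w v)) ⟩
      ∑[ w < n ] (⟦ free F w ⟧ + ⟦ hitBy F w ∧ outside w ⟧ + ⟦ eqᵇ w u ⟧ + ⟦ eqᵇ w v ⟧)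
        ≡⟨ trans (∑-distrib-+₄ n (λ w → ⟦ free F w ⟧) (λ w → ⟦ hitBy F w ∧ outside w ⟧) _ _)
                 (cong₂ _+_ (cong (count n (free F) + count n (λ w → hitBy F w ∧ outside w) +_) (sum-⟦eqᵇ⟧ n u))
                            (sum-⟦eqᵇ⟧ n v)) ⟩
      count n (free F) + count n (λ w → hitBy F w ∧ outside w) + 1 + 1
        ≡⟨ ℕₚ.+-assoc (count n (free F) + _) 1 1 ⟩
      count n (free F) + count n (λ w → hitBy F w ∧ outside w) + 2
        ≤⟨ ℕₚ.+-monoˡ-≤ 2 (ℕₚ.+-monoʳ-≤ (count n (free F)) (count-hit-outside F)) ⟩
      count n (free F) + countClass classOf i F + 2 ∎
      where open ℕₚ.≤-Reasoning

    ⌊n/2⌋≤count-free : ∀ F → countClass classOf i F + 2 ≤ ⌈ n /2⌉ → ⌊ n /2⌋ ≤ count n (free F)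
    ⌊n/2⌋≤count-free F few = ℕₚ.+-cancelʳ-≤ ⌈ n /2⌉ _ _ (begin
      ⌊ n /2⌋ + ⌈ n /2⌉                             ≡⟨ ℕₚ.⌊n/2⌋+⌈n/2⌉≡n n ⟩
      n                                             ≤⟨ n≤free+class+2 F ⟩
      count n (free F) + countClass classOf i F + 2 ≡⟨ ℕₚ.+-assoc (count n (free F)) _ 2 ⟩
      count n (free F) + (countClass classOf i F + 2) ≤⟨ ℕₚ.+-monoʳ-≤ (count n (free F)) few ⟩
      count n (free F) + ⌈ n /2⌉                    ∎)
      where open ℕₚ.≤-Reasoning

    module CutGraph (S : Fin n → Bool) (u∉S : S u ≡ false) (v∉S : S v ≡ false) where

      cutEdge : Pair n → Bool
      cutEdge (a , b) = (S a xor S b) ∨ (eqᵇ a u ∧ eqᵇ b v)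

      cutGraph : Graph n
      cutGraph = filterᵇ cutEdge (pairs n)

      e-cutGraph : e cutGraph ≡ ∑[ a < n ] ∑[ b < n ] (if ltᵇ a b then ⟦ cutEdge (a , b) ⟧ else 0)
      e-cutGraph = trans (length-filterᵇ cutEdge (pairs n)) (sumList-pairs n (λ ab → ⟦ cutEdge ab ⟧))

      crossings+1≤e-cutGraph : crossings n S + 1 ≤ e cutGraph
      crossings+1≤e-cutGraph = begin
        crossings n S + 1
          ≡⟨ cong (crossings n S +_) (sym uv-once) ⟩
        crossings n S + ∑[ a < n ] ∑[ b < n ] ⟦ eqᵇ a u ∧ eqᵇ b v ⟧
          ≡⟨ trans (sum-cong-≗ {n} (λ a → ∑-distrib-+ {n} _ _)) (∑-distrib-+ {n} _ _) ⟨
        ∑[ a < n ] ∑[ b < n ] (⟦ ltᵇ a b ∧ (S a xor S b) ⟧ + ⟦ eqᵇ a u ∧ eqᵇ b v ⟧)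
          ≤⟨ sum-mono n (λ a → sum-mono n (λ b → entry a b)) ⟩
        ∑[ a < n ] ∑[ b < n ] (if ltᵇ a b then ⟦ cutEdge (a , b) ⟧ else 0)
          ≡⟨ e-cutGraph ⟨
        e cutGraph ∎
        where
        open ℕₚ.≤-Reasoning
        uv-once : ∑[ a < n ] ∑[ b < n ] ⟦ eqᵇ a u ∧ eqᵇ b v ⟧ ≡ 1
        uv-once = trans (sum-cong-≗ row) (trans (sum-at n u _) (sum-⟦eqᵇ⟧ n v))
          where
          row : ∀ a → ∑[ b < n ] ⟦ eqᵇ a u ∧ eqᵇ b v ⟧ ≡ (if eqᵇ a u then ∑[ b < n ] ⟦ eqᵇ b v ⟧ else 0)
          row a with eqᵇ a u
          ... | true  = refl
          ... | false = sum-zero n (λ _ → refl)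
        entry : ∀ a b → ⟦ ltᵇ a b ∧ (S a xor S b) ⟧ + ⟦ eqᵇ a u ∧ eqᵇ b v ⟧
                        ≤ (if ltᵇ a b then ⟦ cutEdge (a , b) ⟧ else 0)
        entry a b with eqᵇ a u in a=u | eqᵇ b v in b=v
        ... | true | true with eqᵇ-sound {a = a} {u} (subst T (sym a=u) _) | eqᵇ-sound {a = b} {v} (subst T (sym b=v) _)
        ...   | refl | refl rewrite u<ᵇv | u∉S | v∉S = s≤s z≤n
        entry a b | true  | false = ⟦∧∨false⟧ (ltᵇ a b) (S a xor S b)
        entry a b | false | _     = ⟦∧∨false⟧ (ltᵇ a b) (S a xor S b)

      private
        xor-self : ∀ x → T (x xor x) → ⊥
        xor-self true  ()
        xor-self false ()

        no-odd-cycle : ∀ x y z → T (x xor y) → T (y xor z) → T (x xor z) → ⊥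
        no-odd-cycle true  true  z     ()
        no-odd-cycle false false z     ()
        no-odd-cycle true  false true  _ _ ()
        no-odd-cycle true  false false _ ()
        no-odd-cycle false true  true  _ ()
        no-odd-cycle false true  false _ _ ()

        in-Sˡ : ∀ x → T (S u xor S x) → T (S x)
        in-Sˡ x u-x rewrite u∉S = u-x

        in-Sʳ : ∀ x → T (S x xor S u) → T (S x)
        in-Sʳ x x-u = in-Sˡ x (subst T (Boolₚ.xor-comm (S x) (S u)) x-u)

        crossing : ∀ {x y} → T (cutEdge (x , y)) → ¬ (x ≡ u × y ≡ v) → T (S x xor S y)
        crossing {x} {y} edge not-uv with S x xor S y
        ... | true  = _
        ... | false = not-uv (Prod.map eqᵇ-sound eqᵇ-sound (Equivalence.to Boolₚ.T-∧ edge))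

      -- Bipartite edges form no triangle, so a triangle uses uv and its third vertex lies in S.
      triangle : ∀ {a b c} → T (cutEdge (a , b)) → T (cutEdge (a , c)) → T (cutEdge (b , c)) →
                 classOf (a , b , c) ≡ i × Σ[ w ∈ Fin n ] (T (contains w (a , b , c)) × T (S w))
      triangle {a} {b} {c} ab ac bc with (a ≟ u) ×-dec (b ≟ v)
      ... | yes (refl , refl) = classOf-≡ u v c (inj₁ (pairOf-u , pairOf-v)) , c ,
            ∈-contains c u v c (inj₂ (inj₂ refl)) , in-Sˡ c (crossing ac (λ (_ , c≡v) → c≢v c≡v))
        where
        c≢v : c ≢ v
        c≢v refl = xor-self (S v) (crossing bc (λ (v≡u , _) → u≢v (sym v≡u)))
      ... | no ab≢uv with (b ≟ u) ×-dec (c ≟ v)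
      ...   | yes (refl , refl) = classOf-≡ a u v (inj₂ (inj₁ (pairOf-u , pairOf-v))) , a ,
              ∈-contains a a u v (inj₁ refl) , in-Sʳ a (crossing ab ab≢uv)
      ...   | no bc≢uv with (a ≟ u) ×-dec (c ≟ v)
      ...     | yes (refl , refl) = classOf-≡ u b v (inj₂ (inj₂ (pairOf-u , pairOf-v))) , b ,
                ∈-contains b u b v (inj₂ (inj₁ refl)) , in-Sˡ b (crossing ab ab≢uv)
      ...     | no ac≢uv = ⊥-elim (no-odd-cycle (S a) (S b) (S c)
                             (crossing ab ab≢uv) (crossing bc bc≢uv) (crossing ac ac≢uv))

      ∈ᵇ-cutGraph : ∀ {x y} → T ((x , y) ∈ᵇ cutGraph) → T (cutEdge (x , y))
      ∈ᵇ-cutGraph {x} {y} xy∈ with find (any⁻ _ cutGraph xy∈)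
      ... | (c , d) , cd∈ , xy≟cd with Equivalence.to Boolₚ.T-∧ xy≟cd
      ... | x≟c , y≟d with toWitness {a? = x ≟ c} x≟c | toWitness {a? = y ≟ d} y≟d
      ... | refl | refl = proj₂ (∈-filter⁻ (T? ∘ cutEdge) {xs = pairs n} cd∈)

      module _ (F : Hyp3 n) (S⊆free : ∀ {w} → T (S w) → T (free F w)) where

        cutGraph-undetected : ¬ T (detects F cutGraph)
        cutGraph-undetected detected with find (any⁻ _ F detected)
        ... | (a , b , c) , t∈F , spans with Equivalence.to Boolₚ.T-∧ spans
        ... | ab , ac∧bc with Equivalence.to Boolₚ.T-∧ ac∧bc
        ... | ac , bc with triangle (∈ᵇ-cutGraph ab) (∈ᵇ-cutGraph ac) (∈ᵇ-cutGraph bc)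
        ... | class≡i , w , w∈t , w∈S = subst T not-hit hit
          where
          hit : T (hitBy F w)
          hit = any⁺ _ (lose t∈F (Equivalence.from Boolₚ.T-∧ (ℕₚ.≡⇒≡ᵇ _ _ class≡i , w∈t)))
          not-hit : hitBy F w ≡ false
          not-hit = Equivalence.to Boolₚ.T-not-≡ (proj₁ (Equivalence.to Boolₚ.T-∧ (S⊆free w∈S)))

        cutGraph-refutes : count n S ≡ ⌊ n /2⌋ → ¬ T (turannical F)
        cutGraph-refutes |S| turannical-F = ℕₚ.<⇒≱ t3<e e≤t3
          where
          verdict : T ((e cutGraph ≤ᵇ t3 n) ∨ detects F cutGraph)
          verdict = All.lookup (all⁺ _ (allGraphs n) turannical-F) (RandomSubsets.filterᵇ∈subsets cutEdge (pairs n))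
          e≤t3 : e cutGraph ≤ t3 n
          e≤t3 = ℕₚ.≤ᵇ⇒≤ _ _ ([ id , ⊥-elim ∘ cutGraph-undetected ] (Equivalence.to Boolₚ.T-∨ verdict))
          |Sᶜ| : count n (λ w → not (S w)) ≡ ⌈ n /2⌉
          |Sᶜ| = ℕₚ.+-cancelˡ-≡ ⌊ n /2⌋ _ _ (begin-equality
            ⌊ n /2⌋ + count n (λ w → not (S w)) ≡⟨ cong (_+ count n (λ w → not (S w))) |S| ⟨
            count n S + count n (λ w → not (S w)) ≡⟨ count+count-not n S ⟩
            n                                   ≡⟨ ℕₚ.⌊n/2⌋+⌈n/2⌉≡n n ⟨
            ⌊ n /2⌋ + ⌈ n /2⌉                   ∎)
            where open ℕₚ.≤-Reasoning
          t3<e : t3 n < e cutGraph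
          t3<e = begin-strict
            t3 n                  ≤⟨ t3≤⌊n/2⌋*⌈n/2⌉ n ⟩
            ⌊ n /2⌋ * ⌈ n /2⌉     ≡⟨ trans (crossings≡ n S) (cong₂ _*_ |S| |Sᶜ|) ⟨
            crossings n S         <⟨ ℕₚ.m<m+n (crossings n S) (s≤s z≤n) ⟩
            crossings n S + 1     ≤⟨ crossings+1≤e-cutGraph ⟩
            e cutGraph            ∎
            where open ℕₚ.≤-Reasoning

    turannical⇒class-large : ∀ F → T (turannical F) → ⌈ n /2⌉ ≤ suc (countClass classOf i F)
    turannical⇒class-large F turannical-F with ⌈ n /2⌉ ≤? suc (countClass classOf i F)
    ... | yes large = large
    ... | no  small = ⊥-elim (CutGraph.cutGraph-refutes S (pair∉S (inj₁ refl)) (pair∉S (inj₂ refl))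
                                F S⊆free |S| turannical-F)
      where
      few : countClass classOf i F + 2 ≤ ⌈ n /2⌉
      few = subst (_≤ ⌈ n /2⌉) (ℕₚ.+-comm 2 _) (ℕₚ.≰⇒> small)
      S : Fin n → Bool
      S = proj₁ (choose n (free F) ⌊ n /2⌋ (⌊n/2⌋≤count-free F few))
      S⊆free : ∀ {w} → T (S w) → T (free F w)
      S⊆free = proj₁ (proj₂ (choose n (free F) ⌊ n /2⌋ (⌊n/2⌋≤count-free F few)))
      |S| : count n S ≡ ⌊ n /2⌋
      |S| = proj₂ (proj₂ (choose n (free F) ⌊ n /2⌋ (⌊n/2⌋≤count-free F few)))
      pair∉S : ∀ {x} → InPair x → S x ≡ false
      pair∉S {x} x∈pair with S x in x∈S
      ... | false = refl
      ... | true  = ⊥-elim (outside⇒≢ (free⇒outside (S⊆free (Equivalence.from Boolₚ.T-≡ x∈S))) x∈pair refl)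
        where free⇒outside = proj₂ ∘ Equivalence.to (Boolₚ.T-∧ {not (hitBy F x)})

    private
      toℕ-≢ : ∀ {a b : Fin n} → toℕ a ≢ toℕ b → a ≢ b
      toℕ-≢ toℕ-a≢b a≡b = toℕ-a≢b (cong toℕ a≡b)

    -- Since v = u + 1, every vertex is below u, equal to u or v, or above v.
    below-at-above : ∀ c → ⟦ ltᵇ v c ⟧ + ⟦ ltᵇ c u ⟧ + ⟦ eqᵇ c u ⟧ + ⟦ eqᵇ c v ⟧ ≡ 1
    below-at-above c with ℕₚ.<-cmp (toℕ c) (toℕ u)
    ... | tri< c<u _ _ rewrite ltᵇ-false {a = v} {c} (ℕₚ.<⇒≯ (ℕₚ.<-trans c<u u<v)) | ltᵇ-true c<u
                             | eqᵇ-≢ (toℕ-≢ (ℕₚ.<⇒≢ c<u)) | eqᵇ-≢ (toℕ-≢ (ℕₚ.<⇒≢ (ℕₚ.<-trans c<u u<v))) = refl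
    ... | tri≈ _ c≡u _ rewrite toℕ-injective c≡u | ltᵇ-false {a = v} {u} (ℕₚ.<⇒≯ u<v)
                             | ltᵇ-false {a = u} {u} (ℕₚ.<-irrefl refl)
                             | eqᵇ-refl u | eqᵇ-≢ u≢v = refl
    ... | tri> _ _ u<c with ℕₚ.<-cmp (toℕ c) (toℕ v)
    ...   | tri< c<v _ _ = ⊥-elim (ℕₚ.<⇒≱ c<v (subst (_≤ toℕ c) (sym v≡1+u) u<c))
    ...   | tri≈ _ c≡v _ rewrite toℕ-injective c≡v | ltᵇ-false {a = v} {v} (ℕₚ.<-irrefl refl)
                               | ltᵇ-false {a = v} {u} (ℕₚ.<⇒≯ u<v) | eqᵇ-≢ (≢-sym u≢v) | eqᵇ-refl v = refl
    ...   | tri> _ _ v<c rewrite ltᵇ-true {a = v} {c} v<c | ltᵇ-false {a = c} {u} (ℕₚ.<⇒≯ u<c)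
                             | eqᵇ-≢ (toℕ-≢ (ℕₚ.>⇒≢ u<c)) | eqᵇ-≢ (toℕ-≢ (ℕₚ.>⇒≢ v<c)) = refl

    private
      sorted-pair : ∀ {x y} → InPair x → InPair y → ltᵇ x y ≡ true → x ≡ u × y ≡ v
      sorted-pair (inj₁ refl) (inj₁ refl) u<u = ⊥-elim (ℕₚ.<-irrefl refl (ltᵇ-sound u u u<u))
      sorted-pair (inj₁ refl) (inj₂ refl) _   = refl , refl
      sorted-pair (inj₂ refl) (inj₁ refl) v<u = ⊥-elim (ℕₚ.<-asym u<v (ltᵇ-sound v u v<u))
      sorted-pair (inj₂ refl) (inj₂ refl) v<v = ⊥-elim (ℕₚ.<-irrefl refl (ltᵇ-sound v v v<v))

      after-pair before-pair : Fin n → Fin n → Fin n → ℕ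
      after-pair  a b c = if eqᵇ a u then (if eqᵇ b v then ⟦ ltᵇ v c ⟧ else 0) else 0
      before-pair a b c = if eqᵇ b u then (if eqᵇ c v then ⟦ ltᵇ a u ⟧ else 0) else 0

    -- A sorted triple of class i is (u, v, c) with v < c, or (a, u, v) with a < u.
    sorted-class-i : ∀ a b c → (if ltᵇ a b ∧ ltᵇ b c then ⟦ classOf (a , b , c) ≡ᵇ i ⟧ else 0)
                              ≤ after-pair a b c + before-pair a b c
    sorted-class-i a b c with ltᵇ a b in a<b | ltᵇ b c in b<c | classOf (a , b , c) ≡ᵇ i in class
    ... | false | _     | _     = z≤n
    ... | true  | false | _     = z≤n
    ... | true  | true  | false = z≤n
    ... | true  | true  | true  with repeated-TwoOf (ℕₚ.≡ᵇ⇒≡ _ _ (Equivalence.from Boolₚ.T-≡ class)) i≢n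
    ...   | inj₁ (a∈ , b∈) with sorted-pair {a} {b} (pairOf≡i⇒InPair a∈) (pairOf≡i⇒InPair b∈) a<b
    ...     | refl , refl rewrite eqᵇ-refl u | eqᵇ-refl v | b<c = s≤s z≤n
    sorted-class-i a b c | true | true | true | inj₂ (inj₁ (b∈ , c∈))
      with sorted-pair {b} {c} (pairOf≡i⇒InPair b∈) (pairOf≡i⇒InPair c∈) b<c
    ...     | refl , refl rewrite eqᵇ-refl u | eqᵇ-refl v | a<b = ℕₚ.m≤n+m 1 _
    sorted-class-i a b c | true | true | true | inj₂ (inj₂ (a∈ , c∈))
      with sorted-pair {a} {c} (pairOf≡i⇒InPair a∈) (pairOf≡i⇒InPair c∈)
                       (ltᵇ-true (ℕₚ.<-trans (ltᵇ-sound a b a<b) (ltᵇ-sound b c b<c)))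
    ...     | refl , refl = ⊥-elim (ℕₚ.<⇒≱ (ltᵇ-sound b v b<c) (subst (_≤ toℕ b) (sym v≡1+u) (ltᵇ-sound u b a<b)))

    after-pair-total : ∑[ a < n ] ∑[ b < n ] ∑[ c < n ] after-pair a b c ≡ ∑[ c < n ] ⟦ ltᵇ v c ⟧
    after-pair-total = begin
      ∑[ a < n ] ∑[ b < n ] ∑[ c < n ] after-pair a b c
        ≡⟨ sum-cong-≗ {n} (λ a → trans (sum-cong-≗ {n} (λ b → sum-if n (eqᵇ a u) _)) (sum-if n (eqᵇ a u) _)) ⟩
      ∑[ a < n ] (if eqᵇ a u then ∑[ b < n ] ∑[ c < n ] (if eqᵇ b v then ⟦ ltᵇ v c ⟧ else 0) else 0)
        ≡⟨ sum-at n u _ ⟩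
      ∑[ b < n ] ∑[ c < n ] (if eqᵇ b v then ⟦ ltᵇ v c ⟧ else 0)
        ≡⟨ sum-cong-≗ {n} (λ b → sum-if n (eqᵇ b v) _) ⟩
      ∑[ b < n ] (if eqᵇ b v then ∑[ c < n ] ⟦ ltᵇ v c ⟧ else 0)
        ≡⟨ sum-at n v _ ⟩
      ∑[ c < n ] ⟦ ltᵇ v c ⟧ ∎
      where open ≡-Reasoning

    before-pair-total : ∑[ a < n ] ∑[ b < n ] ∑[ c < n ] before-pair a b c ≡ ∑[ a < n ] ⟦ ltᵇ a u ⟧
    before-pair-total = sum-cong-≗ {n} λ a →
      trans (sum-cong-≗ {n} (λ b → trans (sum-if n (eqᵇ b u) _) (cong (λ s → if eqᵇ b u then s else 0) (sum-at n v _))))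
            (sum-at n u _)

    outside-pair-total : ∑[ c < n ] ⟦ ltᵇ v c ⟧ + ∑[ c < n ] ⟦ ltᵇ c u ⟧ + 2 ≡ n
    outside-pair-total = begin
      ∑[ c < n ] ⟦ ltᵇ v c ⟧ + ∑[ c < n ] ⟦ ltᵇ c u ⟧ + 2
        ≡⟨ ℕₚ.+-assoc (∑[ c < n ] ⟦ ltᵇ v c ⟧ + ∑[ c < n ] ⟦ ltᵇ c u ⟧) 1 1 ⟨
      ∑[ c < n ] ⟦ ltᵇ v c ⟧ + ∑[ c < n ] ⟦ ltᵇ c u ⟧ + 1 + 1
        ≡⟨ cong₂ _+_ (cong (∑[ c < n ] ⟦ ltᵇ v c ⟧ + ∑[ c < n ] ⟦ ltᵇ c u ⟧ +_) (sum-⟦eqᵇ⟧ n u))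
                     (sum-⟦eqᵇ⟧ n v) ⟨
      ∑[ c < n ] ⟦ ltᵇ v c ⟧ + ∑[ c < n ] ⟦ ltᵇ c u ⟧ + ∑[ c < n ] ⟦ eqᵇ c u ⟧ + ∑[ c < n ] ⟦ eqᵇ c v ⟧
        ≡⟨ ∑-distrib-+₄ n (λ c → ⟦ ltᵇ v c ⟧) (λ c → ⟦ ltᵇ c u ⟧) _ _ ⟨
      ∑[ c < n ] (⟦ ltᵇ v c ⟧ + ⟦ ltᵇ c u ⟧ + ⟦ eqᵇ c u ⟧ + ⟦ eqᵇ c v ⟧)
        ≡⟨ sum-cong-≗ below-at-above ⟩
      ∑[ c < n ] 1
        ≡⟨ sum-one n ⟩
      n ∎
      where open ≡-Reasoning

    class-size : countClass classOf i (triples n) + 2 ≤ n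
    class-size = begin
      countClass classOf i (triples n) + 2
        ≡⟨ cong (_+ 2) (sumList-triples n _) ⟩
      ∑[ a < n ] ∑[ b < n ] ∑[ c < n ] (if ltᵇ a b ∧ ltᵇ b c then ⟦ classOf (a , b , c) ≡ᵇ i ⟧ else 0) + 2
        ≤⟨ ℕₚ.+-monoˡ-≤ 2 (sum-mono n λ a → sum-mono n λ b → sum-mono n λ c → sorted-class-i a b c) ⟩
      ∑[ a < n ] ∑[ b < n ] ∑[ c < n ] (after-pair a b c + before-pair a b c) + 2
        ≡⟨ cong (_+ 2) (trans (sum-cong-≗ {n} λ a → trans (sum-cong-≗ {n} λ b → ∑-distrib-+ {n} _ _)
                                                           (∑-distrib-+ {n} _ _))
                              (∑-distrib-+ {n} _ _)) ⟩
      ∑[ a < n ] ∑[ b < n ] ∑[ c < n ] after-pair a b c + ∑[ a < n ] ∑[ b < n ] ∑[ c < n ] before-pair a b c + 2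
        ≡⟨ cong (_+ 2) (cong₂ _+_ after-pair-total before-pair-total) ⟩
      ∑[ c < n ] ⟦ ltᵇ v c ⟧ + ∑[ c < n ] ⟦ ltᵇ c u ⟧ + 2
        ≡⟨ outside-pair-total ⟩
      n ∎
      where open ℕₚ.≤-Reasoning

module GeometricDecay where
  import Data.Nat as ℕ
  import Data.Nat.Properties as ℕₚ
  import Data.Integer as ℤ
  import Data.Integer.Properties as ℤₚ
  import Data.Rational.Unnormalised as ℚᵘ
  import Data.Rational.Unnormalised.Properties as ℚᵘₚ
  open import Data.Nat using (ℕ; zero; suc)
  open import Data.Product using (∃-syntax; _,_)
  open import Data.Rational
  open import Data.Rational.Properties
  open import Relation.Binary.PropositionalEquality
  open import Tactic.RingSolver using (solve-∀)
  open import Defs using (_^_)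
  open RationalArithmetic
  open BinomialTail using (¾)

  fromℕ : ℕ → ℚ
  fromℕ zero    = 0ℚ
  fromℕ (suc k) = 1ℚ + fromℕ k

  fromℕ-+ : ∀ k j → fromℕ (k ℕ.+ j) ≡ fromℕ k + fromℕ j
  fromℕ-+ zero    j = sym (+-identityˡ (fromℕ j))
  fromℕ-+ (suc k) j = trans (cong (1ℚ +_) (fromℕ-+ k j)) (sym (+-assoc 1ℚ (fromℕ k) (fromℕ j)))

  0≤fromℕ : ∀ k → 0ℚ ≤ fromℕ k
  0≤fromℕ zero    = ≤-refl
  0≤fromℕ (suc k) = +-mono-≤ 0≤1 (0≤fromℕ k)

  fromℕ-mono : ∀ {k j} → k ℕ.≤ j → fromℕ k ≤ fromℕ j
  fromℕ-mono {k} {j} k≤j = subst₂ _≤_ (+-identityʳ (fromℕ k))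
    (trans (sym (fromℕ-+ k (j ℕ.∸ k))) (cong fromℕ (ℕₚ.m+[n∸m]≡n k≤j)))
    (+-monoʳ-≤ (fromℕ k) (0≤fromℕ (j ℕ.∸ k)))

  toℚᵘ-fromℕ : ∀ k → toℚᵘ (fromℕ k) ℚᵘ.≃ ℚᵘ.mkℚᵘ (ℤ.+ k) 0
  toℚᵘ-fromℕ zero    = ℚᵘ.*≡* refl
  toℚᵘ-fromℕ (suc k) = ℚᵘₚ.≃-trans (toℚᵘ-homo-+ 1ℚ (fromℕ k))
    (ℚᵘₚ.≃-trans (ℚᵘₚ.+-congʳ (toℚᵘ 1ℚ) (toℚᵘ-fromℕ k)) (ℚᵘ.*≡* cross-multiplied))
    where
    cross-multiplied : (ℤ.+ 1 ℤ.* ℤ.+ 1 ℤ.+ ℤ.+ k ℤ.* ℤ.+ 1) ℤ.* ℤ.+ 1 ≡ ℤ.+ suc k ℤ.* (ℤ.+ 1 ℤ.* ℤ.+ 1)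
    cross-multiplied rewrite ℤₚ.*-identityʳ (ℤ.+ k) = refl

  -- For ε = (a + 1)/(d + 1), the witness b = 3(d + 1) + 1 gives ε·b > 3.
  archimedean : ∀ ε → 0ℚ < ε → ∃[ b ] fromℕ 3 < ε * fromℕ b
  archimedean (mkℚ (ℤ.+ zero) d _) (*<* (ℤ.+<+ ()))
  archimedean (mkℚ (ℤ.+ suc a) d c) 0<ε = b , toℚᵘ-cancel-< (ℚᵘₚ.<-respʳ-≃ (ℚᵘₚ.≃-sym εb≃) 3<εb)
    where
    b = suc (3 ℕ.* suc d)
    εb≃ : toℚᵘ (mkℚ (ℤ.+ suc a) d c * fromℕ b) ℚᵘ.≃ (ℚᵘ.mkℚᵘ (ℤ.+ suc a) d ℚᵘ.* ℚᵘ.mkℚᵘ (ℤ.+ b) 0)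
    εb≃ = ℚᵘₚ.≃-trans (toℚᵘ-homo-* (mkℚ (ℤ.+ suc a) d c) (fromℕ b))
                      (ℚᵘₚ.*-congˡ {toℚᵘ (mkℚ (ℤ.+ suc a) d c)} (toℚᵘ-fromℕ b))
    3<εb : toℚᵘ (fromℕ 3) ℚᵘ.< (ℚᵘ.mkℚᵘ (ℤ.+ suc a) d ℚᵘ.* ℚᵘ.mkℚᵘ (ℤ.+ b) 0)
    3<εb = ℚᵘ.*<* (subst₂ ℤ._<_ (sym (ℤₚ.pos-* 3 (suc (d ℕ.* 1))))
                    (trans (sym (ℤₚ.pos-* (suc a ℕ.* b) 1)) (cong (ℤ._* ℤ.+ 1) (sym (ℤₚ.pos-* (suc a) b))))
                    (ℤ.+<+ 3d+3<ab))
      where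
      3d+3<ab : 3 ℕ.* suc (d ℕ.* 1) ℕ.< (suc a ℕ.* b) ℕ.* 1
      3d+3<ab rewrite ℕₚ.*-identityʳ d | ℕₚ.*-identityʳ (suc a ℕ.* b) =
        ℕₚ.<-≤-trans (ℕₚ.n<1+n _) (ℕₚ.m≤n*m b (suc a))

  ¾[1+Y]≤Y : ∀ Y → fromℕ 3 ≤ Y → ¾ * (1ℚ + Y) ≤ Y
  ¾[1+Y]≤Y Y 3≤Y = begin
    ¾ * (1ℚ + Y)     ≡⟨ *-distribˡ-+ ¾ 1ℚ Y ⟩
    ¾ * 1ℚ + ¾ * Y   ≡⟨⟩
    ¼ * fromℕ 3 + ¾ * Y ≤⟨ +-monoˡ-≤ (¾ * Y) (*-monoˡ-≤-0≤ {¼} (≤ᵇ⇒≤ _) 3≤Y) ⟩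
    ¼ * Y + ¾ * Y    ≡⟨ *-distribʳ-+ Y ¼ ¾ ⟨
    1ℚ * Y           ≡⟨ *-identityˡ Y ⟩
    Y                ∎
    where
    open ≤-Reasoning
    ¼ : ℚ
    ¼ = ℤ.+ 1 / 4

  ¾^m*[m+3]≤3 : ∀ m → ¾ ^ m * fromℕ (m ℕ.+ 3) ≤ fromℕ 3
  ¾^m*[m+3]≤3 zero    = ≤-reflexive (*-identityˡ (fromℕ 3))
  ¾^m*[m+3]≤3 (suc m) = begin
    (¾ * ¾ ^ m) * (1ℚ + X)  ≡⟨ reassoc ¾ (¾ ^ m) X ⟩
    ¾ ^ m * (¾ * (1ℚ + X))  ≤⟨ *-monoˡ-≤-0≤ (0≤p^k (≤ᵇ⇒≤ _) m) (¾[1+Y]≤Y X (fromℕ-mono (ℕₚ.m≤n+m 3 m))) ⟩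
    ¾ ^ m * X               ≤⟨ ¾^m*[m+3]≤3 m ⟩
    fromℕ 3                 ∎
    where
    open ≤-Reasoning
    X = fromℕ (m ℕ.+ 3)
    reassoc : ∀ a b X → (a * b) * (1ℚ + X) ≡ b * (a * (1ℚ + X))
    reassoc = solve-∀ ℚ-ring

  ¾^m→0 : ∀ ε → 0ℚ < ε → ∃[ M ] (∀ m → M ℕ.≤ m → ¾ ^ m < ε)
  ¾^m→0 ε 0<ε with archimedean ε 0<ε
  ... | M , 3<εM = M , λ m M≤m → *-cancelʳ-<-nonNeg (fromℕ (m ℕ.+ 3)) {{nonNegative (0≤fromℕ (m ℕ.+ 3))}} (begin-strict
    ¾ ^ m * fromℕ (m ℕ.+ 3) ≤⟨ ¾^m*[m+3]≤3 m ⟩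
    fromℕ 3                 <⟨ 3<εM ⟩
    ε * fromℕ M             ≤⟨ *-monoˡ-≤-0≤ (<⇒≤ 0<ε) (fromℕ-mono (ℕₚ.≤-trans M≤m (ℕₚ.m≤m+n m 3))) ⟩
    ε * fromℕ (m ℕ.+ 3)     ∎)
    where open ≤-Reasoning

module TurannicalBound where
  import Data.Nat as ℕ
  import Data.Nat.Properties as ℕₚ
  open import Data.Nat using (ℕ; zero; suc; s≤s; ⌊_/2⌋; ⌈_/2⌉)
  open import Data.Nat.Tactic.RingSolver using (solve-∀)
  open import Data.Product using (_,_)
  open import Data.Bool using (T)
  open import Data.Product using (_×_; proj₁)
  open import Data.Rational using (0ℚ; 1ℚ; ½; _≤_)
  open import Data.Rational.Properties using (≤-trans; ≤ᵇ⇒≤; module ≤-Reasoning)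
  open import Relation.Binary.PropositionalEquality
  open import Defs using (triples; turannical; probTurannical; _^_)
  open BinomialTail
  open RandomSubsets
  open IndependentClasses
  open ListCounts
  open Halving

  probTurannical≤¾^⌊n/2⌋ : ∀ {p} → 0ℚ ≤ p → p ≤ ½ → ∀ n → 3 ℕ.≤ n → probTurannical n p ≤ ¾ ^ ⌊ n /2⌋
  probTurannical≤¾^⌊n/2⌋ 0≤p p≤½ (suc zero)       (s≤s ())
  probTurannical≤¾^⌊n/2⌋ 0≤p p≤½ (suc (suc zero)) (s≤s (s≤s ()))
  probTurannical≤¾^⌊n/2⌋ {p} 0≤p p≤½ n@(suc (suc (suc n′))) _ = begin
    Pr p (triples n) turannical
      ≤⟨ Pr-mono p 0≤p p≤1 (triples n) all-classes-large ⟩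
    Pr p (triples n) (classCounts≥ classOf ⌊ n /2⌋ (λ _ → τ))
      ≡⟨ Pr-classCounts≥ classOf ⌊ n /2⌋ p (triples n) (λ _ → τ) ⟩
    ∏< ⌊ n /2⌋ (λ i → Bin≥ p (countClass classOf i (triples n)) τ)
      ≤⟨ ∏<-≤-^ ⌊ n /2⌋ (≤ᵇ⇒≤ _) each-≤¾ ⟩
    ¾ ^ ⌊ n /2⌋ ∎
    where
    open ≤-Reasoning
    open PairClasses n using (classOf; module VertexPair)
    p≤1 : p ≤ 1ℚ
    p≤1 = ≤-trans p≤½ (≤ᵇ⇒≤ _)
    τ : ℕ
    τ = ⌈ n /2⌉ ℕ.∸ 1
    all-classes-large : ∀ F → T (turannical F) → T (classCounts≥ classOf ⌊ n /2⌋ (λ _ → τ) F)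
    all-classes-large F turannical-F = all<-intro ⌊ n /2⌋ λ i<⌊n/2⌋ →
      ℕₚ.≤⇒≤ᵇ (ℕₚ.m≤n+o⇒m∸n≤o ⌈ n /2⌉ 1
        (VertexPair.turannical⇒class-large _ (i<⌊n/2⌋⇒2i+1<n i<⌊n/2⌋) F turannical-F))
    each-≤¾ : ∀ {i} → i ℕ.< ⌊ n /2⌋ → 0ℚ ≤ Bin≥ p (countClass classOf i (triples n)) τ
                                      × Bin≥ p (countClass classOf i (triples n)) τ ≤ ¾
    each-≤¾ {i} i<⌊n/2⌋ = proj₁ (Bin≥-bounds 0≤p p≤1 (countClass classOf i (triples n)) τ) ,
      Bin≥-≤¾ 0≤p p≤½ {countClass classOf i (triples n)} ⌊ n′ /2⌋ (ℕₚ.+-cancelʳ-≤ 2 _ _ (ℕₚ.≤-trans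
        (ℕₚ.≤-trans (VertexPair.class-size i (i<⌊n/2⌋⇒2i+1<n i<⌊n/2⌋)) (n≤⌈n/2⌉+⌈n/2⌉ n))
        (ℕₚ.≤-reflexive (regroup ⌊ n′ /2⌋))))
      where regroup : ∀ t → suc (suc t) ℕ.+ suc (suc t) ≡ suc t ℕ.+ suc t ℕ.+ 2
            regroup = solve-∀

open import Defs
open import Data.Nat using (ℕ; _≥_)
open import Data.Rational using (ℚ; 0ℚ; ½; _≤_; _<_)
open import Data.Product using (∃; _×_)
import Data.Nat as ℕ
import Data.Nat.Properties as ℕₚ
open import Data.Product using (_,_)
open import Data.Rational.Properties using (≤-<-trans)
open import Relation.Binary.PropositionalEquality using (subst; sym)
open TurannicalBound using (probTurannical≤¾^⌊n/2⌋)
open GeometricDecay using (¾^m→0)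

lemma5p1 : (p : ℚ) → 0ℚ ≤ p → p ≤ ½ →
    (ε : ℚ) → 0ℚ < ε → ∃ λ (N : ℕ) → (n : ℕ) → n ≥ N → probTurannical n p < ε
lemma5p1 p 0≤p p≤½ ε 0<ε with ¾^m→0 ε 0<ε
... | M , ¾^m<ε = M ℕ.+ M ℕ.+ 3 , λ n n≥N →
  ≤-<-trans (probTurannical≤¾^⌊n/2⌋ 0≤p p≤½ n (3≤n n≥N)) (¾^m<ε ℕ.⌊ n /2⌋ (M≤⌊n/2⌋ n≥N))
  where
  3≤n : ∀ {n} → n ≥ M ℕ.+ M ℕ.+ 3 → 3 ℕ.≤ n
  3≤n = ℕₚ.≤-trans (ℕₚ.m≤n+m 3 (M ℕ.+ M))
  M≤⌊n/2⌋ : ∀ {n} → n ≥ M ℕ.+ M ℕ.+ 3 → M ℕ.≤ ℕ.⌊ n /2⌋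
  M≤⌊n/2⌋ n≥N = subst (ℕ._≤ _) (sym (ℕₚ.n≡⌊n+n/2⌋ M))
                      (ℕₚ.⌊n/2⌋-mono (ℕₚ.≤-trans (ℕₚ.m≤m+n (M ℕ.+ M) 3) n≥N))
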